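{- Let $p$ be a prime, $m\ge1$, and let $(\mathcal C_\star):\mathcal C_0\subseteq\mathcal C_1\subseteq\dots\subseteq\mathcal C_{m-1}\subseteq\mathbb F_p^N$ be a chain of cyclic codes (with $N=n$) or of extended cyclic codes (with $N=n+1$). Assume there is $\gamma\ge1$ such that $\mathrm{dist}_E(\mathcal C_i)\ge p^{2m-2i}/\gamma$ for all $0\le i\le m-1$. Then $\min\mathcal L(\widehat{(\mathcal C_\star)})\ge p^m/\gamma$.
   Context: Let $R=\mathbb Z/p^m\mathbb Z$ and $n\ge1$ with $p\nmid n$. Identify $\mathbb F_p[X]/(X^n-1)$ with $\mathbb F_p^n$ and $R[X]/(X^n-1)$ with $R^n$ via the basis $1,X,\dots,X^{n-1}$; a cyclic code is an ideal of $\mathbb F_p[X]/(X^n-1)$, generated by its unique monic generator polynomial $g\mid X^n-1$; by Hensel's lemma there is a unique monic $G\mid X^n-1$ in $R[X]$ with $G\equiv g\pmod p$. For a chain of cyclic codes $\mathcal C_0\subseteq\dots\subseteq\mathcal C_{m-1}$ with generator polynomials $g_j$ and lifts $G_j$, its lift $\widehat{(\mathcal C_\star)}$ is the ideal $(p^jG_j:0\le j\le m-1)$ of $R[X]/(X^n-1)\cong R^n$. The extended code of $\mathcal C\subseteq A^n$ ($A$ a ring) is $\{(c_1,\dots,c_n,-\sum c_i):(c_i)\in\mathcal C\}$; a chain of extended cyclic codes is the chain of extended codes of a chain of cyclic codes, and its lift is the extended code of the lift of the underlying cyclic chain. Let $b_1,\dots,b_N$ be an orthogonal basis of $\mathbb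 R^N$ with $(b_i,b_i)=p^{ -m}$, $\Omega=\bigoplus\mathbb Zb_i$, and $\mathcal L(\widehat{(\mathcal C_\star)})=\{\sum a_ib_i:a_i\in\mathbb Z,(a_i+p^m\mathbb Z)_i\in\widehat{(\mathcal C_\star)}\}$ (Construction $\mathrm D^{(\mathrm{cyc})}$). The Euclidean weight of $c\in\mathbb F_p^N$ is $w_E(c)=\min\{\sum a_i^2:a_i\in\mathbb Z,a_i\equiv c_i\pmod p\}$, and $\mathrm{dist}_E(\mathcal C)=\min\{w_E(c):0\ne c\in\mathcal C\}$. $\min(L)=\min\{(x,x):0\ne x\in L\}$.
   Formalization: The constant $\gamma\ge1$ takes rational values. -}

module Defs where

open import Data.Nat as ℕ using (ℕ; zero; suc; _∸_; _≡ᵇ_; _^_)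
open import Data.Nat.Properties using (_<?_)
open import Data.Integer as ℤ using (ℤ; +_; -_; _+_; _*_; _-_)
open import Data.Integer.Divisibility using (_∣_)
open import Data.Fin using (Fin; fromℕ; fromℕ<; inject₁)
open import Data.Bool using (if_then_else_)
open import Data.Product using (∃; _×_)
open import Relation.Binary.PropositionalEquality using (_≡_)
open import Relation.Nullary using (¬_; yes; no)
open import Data.Rational as ℚ using (ℚ)

-- Integers modulo q.  Elements of ℤ/qℤ (resp. F_p = ℤ/pℤ) are represented
-- by integer representatives; equality in ℤ/qℤ is congruence mod q.

infix 4 _≡[_]_ _≡ₚ[_]_

_≡[_]_ : ℤ → ℕ → ℤ → Set
a ≡[ q ] b = (+ q) ∣ (a - b)

-- A polynomial over ℤ/qℤ is represented by a finitely supported integer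
-- coefficient sequence, compared coefficientwise modulo q.

Poly : Set
Poly = ℕ → ℤ

FinSupp : Poly → Set
FinSupp f = ∃ λ d → ∀ k → d ℕ.≤ k → f k ≡ + 0

Monic : Poly → Set
Monic f = ∃ λ d → (f d ≡ + 1) × (∀ k → d ℕ.< k → f k ≡ + 0)

_≡ₚ[_]_ : Poly → ℕ → Poly → Set
f ≡ₚ[ q ] g = ∀ k → f k ≡[ q ] g k

sumℕ : ℕ → (ℕ → ℤ) → ℤ
sumℕ zero    f = + 0
sumℕ (suc k) f = sumℕ k f + f k

_⊕_ : Poly → Poly → Poly
(f ⊕ g) k = f k + g k

_·ₚ_ : ℤ → Poly → Poly
(c ·ₚ f) k = c * f k

_⊗_ : Poly → Poly → Poly
(f ⊗ g) k = sumℕ (suc k) (λ i → f i * g (k ∸ i))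

sumPoly : ℕ → (ℕ → Poly) → Poly
sumPoly r F k = sumℕ r (λ j → F j k)

Xⁿ-1 : ℕ → Poly
Xⁿ-1 n k = (if k ≡ᵇ n then + 1 else + 0) - (if k ≡ᵇ 0 then + 1 else + 0)

DividesMod : ℕ → Poly → Poly → Set
DividesMod q G F = ∃ λ H → FinSupp H × ((G ⊗ H) ≡ₚ[ q ] F)

toPoly : (n : ℕ) → (Fin n → ℤ) → Poly
toPoly n c k with k <? n
... | yes k<n = c (fromℕ< k<n)
... | no  _   = + 0

-- The ideal of (ℤ/qℤ)[X]/(X^n-1) ≅ (ℤ/qℤ)^n generated by gens 0 … gens (r-1):
-- c belongs to it iff  Σ_j gens_j F_j ≡ c(X) + (X^n-1) Q  (mod q)
-- for some polynomials F_j, Q.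

InIdeal : (q n : ℕ) → (gens : ℕ → Poly) → (r : ℕ) → (Fin n → ℤ) → Set
InIdeal q n gens r c =
  ∃ λ (F : ℕ → Poly) → (∀ j → FinSupp (F j)) ×
  ∃ λ (Q : Poly) → FinSupp Q ×
    (sumPoly r (λ j → gens j ⊗ F j) ≡ₚ[ q ] (toPoly n c ⊕ (Xⁿ-1 n ⊗ Q)))

CyclicCode : (p n : ℕ) → Poly → (Fin n → ℤ) → Set
CyclicCode p n g = InIdeal p n (λ _ → g) 1

IsGenerator : (p n : ℕ) → Poly → Set
IsGenerator p n g = Monic g × DividesMod p g (Xⁿ-1 n)

IsHenselLift : (p m n : ℕ) → Poly → Poly → Set
IsHenselLift p m n g G = Monic G × DividesMod (p ^ m) G (Xⁿ-1 n) × (G ≡ₚ[ p ] g)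

LiftCode : (p m n : ℕ) → (G : ℕ → Poly) → (Fin n → ℤ) → Set
LiftCode p m n G = InIdeal (p ^ m) n (λ j → (+ (p ^ j)) ·ₚ G j) m

data CodeKind : Set where
  cyclic extended : CodeKind

len : CodeKind → ℕ → ℕ
len cyclic   n = n
len extended n = suc n

sumFin : (N : ℕ) → (Fin N → ℤ) → ℤ
sumFin zero    a = + 0
sumFin (suc N) a = sumFin N (λ i → a (inject₁ i)) + a (fromℕ N)

Extended : (q n : ℕ) → ((Fin n → ℤ) → Set) → (Fin (suc n) → ℤ) → Set
Extended q n P c = P (λ i → c (inject₁ i)) × (c (fromℕ n) ≡[ q ] (- sumFin n (λ i → c (inject₁ i))))

KindCode : (k : CodeKind) (q n : ℕ) → ((Fin n → ℤ) → Set) → (Fin (len k n) → ℤ) → Set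
KindCode cyclic   q n P = P
KindCode extended q n P = Extended q n P

sqNorm : (N : ℕ) → (Fin N → ℤ) → ℤ
sqNorm N a = sumFin N (λ i → a i * a i)

toℚ : ℤ → ℚ
toℚ z = z ℚ./ 1

-- "dist_E(C) ≥ t/γ" (γ > 0) for a code C ⊆ F_p^N, unfolded: every nonzero
-- codeword c has w_E(c) ≥ t/γ, i.e. every integer vector a whose reduction
-- mod p is a nonzero codeword has Σ a_i² ≥ t/γ; written as t ≤ γ·Σ a_i².
DistE≥ : (p N : ℕ) → ((Fin N → ℤ) → Set) → ℕ → ℚ → Set
DistE≥ p N C t γ = ∀ (a : Fin N → ℤ) → C a → ¬ (∀ i → a i ≡[ p ] + 0) →
  toℚ (+ t) ℚ.≤ γ ℚ.* toℚ (sqNorm N a)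

-- Construction D^(cyc): for an orthogonal basis b_i with (b_i,b_i) = p^{-m},
-- x = Σ a_i b_i ∈ L(Ĉ) iff (a_i mod p^m) ∈ Ĉ, x ≠ 0 iff a ≠ 0, and
-- (x,x) = Σ a_i² / p^m.  "min L ≥ t/γ" (γ > 0), unfolded: every nonzero
-- lattice vector has Σ a_i²/p^m ≥ t/γ; written as p^m·t ≤ γ·Σ a_i².
MinLattice≥ : (p m N : ℕ) → ((Fin N → ℤ) → Set) → ℕ → ℚ → Set
MinLattice≥ p m N Ĉ t γ = ∀ (a : Fin N → ℤ) → Ĉ a → ¬ (∀ i → a i ≡ + 0) →
  toℚ (+ (p ^ m ℕ.* t)) ℚ.≤ γ ℚ.* toℚ (sqNorm N a)

module Submission where

-- Let a ≠ 0 be an integer vector reducing into the lift Ĉ = (p^j G_j : j < m)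
-- and let t be its p-adic valuation, capped at m.  If t = m then
-- Σa_i² ≥ p^{2m}.  Otherwise a = p^t·a' with a' ≢ 0 mod p, and a' mod p lies
-- in C_t, so Σa_i² = p^{2t}·Σa'_i² ≥ p^{2t}·p^{2m-2t}/γ (layered-minimum).
-- That a' ∈ C_t is proved in (ℤ/p^m)[X]/(X^n - 1): since p ∤ n, each
-- factorisation G_j·H_j = X^n - 1 has a Bézout relation A_j G_j + B_j H_j = 1
-- (via the Euler operator X·d/dX); the chain condition and the nilpotency of p
-- give G_j·H_i = 0 for j ≤ i; so multiplying a by B_t H_t kills the generators
-- p^j G_j with j ≤ t, cancelling p^t gives a'·B_t H_t ≡ 0 mod p, and hence
-- a' ≡ (a'·A_t)·G_t ≡ (a'·A_t)·g_t mod p (divided-codeword-kind).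

open import Defs
open import Algebra.Bundles using (CommutativeRing)
open import Data.Nat using (ℕ; suc; _<_; _≤_)
open import Data.Nat.Divisibility using (_∣_)
open import Data.Nat.Primality using (Prime)
open import Relation.Nullary using (¬_)

module Polynomials where

  open import Data.Nat as ℕ using (ℕ; zero; suc; _∸_)
  import Data.Nat.Properties as ℕP
  open import Data.Integer using (ℤ; +_; -_; _+_; _*_; _-_)
  import Data.Integer.Properties as ℤP
  open import Data.Integer.Tactic.RingSolver using (solve-∀)
  open import Data.Product using (_,_; proj₂)
  open import Data.Bool using (if_then_else_)
  open import Relation.Nullary using (yes; no)
  open import Relation.Binary.PropositionalEquality
  open import Function using (_∘_)

  sum-cong : ∀ n {f g : ℕ → ℤ} → (∀ i → i ℕ.< n → f i ≡ g i) → sumℕ n f ≡ sumℕ n g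
  sum-cong zero h = refl
  sum-cong (suc n) h = cong₂ _+_ (sum-cong n (λ i i<n → h i (ℕP.m<n⇒m<1+n i<n))) (h n ℕP.≤-refl)

  sum-first : ∀ n (f : ℕ → ℤ) → sumℕ (suc n) f ≡ f 0 + sumℕ n (f ∘ suc)
  sum-first zero f = trans (ℤP.+-identityˡ (f 0)) (sym (ℤP.+-identityʳ (f 0)))
  sum-first (suc n) f = begin
    sumℕ (suc n) f + f (suc n)           ≡⟨ cong (_+ f (suc n)) (sum-first n f) ⟩
    (f 0 + sumℕ n (f ∘ suc)) + f (suc n) ≡⟨ ℤP.+-assoc (f 0) _ _ ⟩
    f 0 + sumℕ (suc n) (f ∘ suc)         ∎
    where open ≡-Reasoning

  sum-+ : ∀ n (f g : ℕ → ℤ) → sumℕ n (λ i → f i + g i) ≡ sumℕ n f + sumℕ n g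
  sum-+ zero f g = refl
  sum-+ (suc n) f g = begin
    sumℕ n (λ i → f i + g i) + (f n + g n) ≡⟨ cong (_+ (f n + g n)) (sum-+ n f g) ⟩
    (sumℕ n f + sumℕ n g) + (f n + g n)    ≡⟨ interchange (sumℕ n f) (sumℕ n g) (f n) (g n) ⟩
    (sumℕ n f + f n) + (sumℕ n g + g n)    ∎
    where
    open ≡-Reasoning
    interchange : ∀ a b c d → (a + b) + (c + d) ≡ (a + c) + (b + d)
    interchange = solve-∀

  sum-* : ∀ n c (f : ℕ → ℤ) → sumℕ n (λ i → c * f i) ≡ c * sumℕ n f
  sum-* zero c f = sym (ℤP.*-zeroʳ c)
  sum-* (suc n) c f = trans (cong (_+ c * f n) (sum-* n c f)) (sym (ℤP.*-distribˡ-+ c _ _))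

  sum-zero : ∀ n (f : ℕ → ℤ) → (∀ i → i ℕ.< n → f i ≡ + 0) → sumℕ n f ≡ + 0
  sum-zero n f h = trans (sum-cong n h) (sum-0 n)
    where
    sum-0 : ∀ n → sumℕ n (λ _ → + 0) ≡ + 0
    sum-0 zero = refl
    sum-0 (suc n) = cong (_+ + 0) (sum-0 n)

  sum-rev : ∀ n (f : ℕ → ℤ) → sumℕ n f ≡ sumℕ n (λ i → f (n ∸ suc i))
  sum-rev zero f = refl
  sum-rev (suc n) f = begin
    sumℕ n f + f n                      ≡⟨ cong (_+ f n) (sum-rev n f) ⟩
    sumℕ n (λ i → f (n ∸ suc i)) + f n  ≡⟨ ℤP.+-comm _ (f n) ⟩
    f n + sumℕ n (λ i → f (n ∸ suc i))  ≡⟨ sym (sum-first n (λ i → f (n ∸ i))) ⟩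
    sumℕ (suc n) (λ i → f (n ∸ i))      ∎
    where open ≡-Reasoning

  tailP : Poly → Poly
  tailP f k = f (suc k)

  conv-zero : ∀ f g → (f ⊗ g) 0 ≡ f 0 * g 0
  conv-zero f g = ℤP.+-identityˡ _

  conv-suc : ∀ f g k → (f ⊗ g) (suc k) ≡ f 0 * g (suc k) + (tailP f ⊗ g) k
  conv-suc f g k = sum-first (suc k) (λ i → f i * g (suc k ∸ i))

  ⊗-congˡ : ∀ {f f'} g → f ≗ f' → f ⊗ g ≗ f' ⊗ g
  ⊗-congˡ g ef k = sum-cong (suc k) (λ i _ → cong (_* g (k ∸ i)) (ef i))

  ⊗-congʳ : ∀ f {g g'} → g ≗ g' → f ⊗ g ≗ f ⊗ g'
  ⊗-congʳ f eg k = sum-cong (suc k) (λ i _ → cong (f i *_) (eg (k ∸ i)))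

  ⊗-comm : ∀ f g → f ⊗ g ≗ g ⊗ f
  ⊗-comm f g k = begin
    sumℕ (suc k) (λ i → f i * g (k ∸ i))             ≡⟨ sum-rev (suc k) _ ⟩
    sumℕ (suc k) (λ i → f (k ∸ i) * g (k ∸ (k ∸ i))) ≡⟨ sum-cong (suc k) swap ⟩
    sumℕ (suc k) (λ i → g i * f (k ∸ i))             ∎
    where
    open ≡-Reasoning
    swap : ∀ i → i ℕ.< suc k → f (k ∸ i) * g (k ∸ (k ∸ i)) ≡ g i * f (k ∸ i)
    swap i i<k = trans (ℤP.*-comm (f (k ∸ i)) _)
                       (cong (λ j → g j * f (k ∸ i)) (ℕP.m∸[m∸n]≡n (ℕP.≤-pred i<k)))

  ⊗-distribʳ : ∀ f g h → (f ⊕ g) ⊗ h ≗ (f ⊗ h) ⊕ (g ⊗ h)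
  ⊗-distribʳ f g h k =
    trans (sum-cong (suc k) (λ i _ → ℤP.*-distribʳ-+ (h (k ∸ i)) (f i) (g i))) (sum-+ (suc k) _ _)

  ⊗-distribˡ : ∀ f g h → f ⊗ (g ⊕ h) ≗ (f ⊗ g) ⊕ (f ⊗ h)
  ⊗-distribˡ f g h k =
    trans (sum-cong (suc k) (λ i _ → ℤP.*-distribˡ-+ (f i) (g (k ∸ i)) (h (k ∸ i)))) (sum-+ (suc k) _ _)

  ⊗-scalarˡ : ∀ c f g → (c ·ₚ f) ⊗ g ≗ c ·ₚ (f ⊗ g)
  ⊗-scalarˡ c f g k = trans (sum-cong (suc k) (λ i _ → ℤP.*-assoc c (f i) _)) (sum-* (suc k) c _)

  ⊗-scalarʳ : ∀ c f g → f ⊗ (c ·ₚ g) ≗ c ·ₚ (f ⊗ g)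
  ⊗-scalarʳ c f g k = trans (sum-cong (suc k) (λ i _ → pull (f i) (g (k ∸ i)) c)) (sum-* (suc k) c _)
    where
    pull : ∀ a b c → a * (c * b) ≡ c * (a * b)
    pull = solve-∀

  ⊗-assoc : ∀ f g h → (f ⊗ g) ⊗ h ≗ f ⊗ (g ⊗ h)
  ⊗-assoc f g h zero = begin
    ((f ⊗ g) ⊗ h) 0   ≡⟨ conv-zero (f ⊗ g) h ⟩
    (f ⊗ g) 0 * h 0   ≡⟨ cong (_* h 0) (conv-zero f g) ⟩
    (f 0 * g 0) * h 0 ≡⟨ ℤP.*-assoc (f 0) (g 0) (h 0) ⟩
    f 0 * (g 0 * h 0) ≡⟨ cong (f 0 *_) (sym (conv-zero g h)) ⟩
    f 0 * (g ⊗ h) 0   ≡⟨ sym (conv-zero f (g ⊗ h)) ⟩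
    (f ⊗ (g ⊗ h)) 0   ∎
    where open ≡-Reasoning
  ⊗-assoc f g h (suc k) = begin
    ((f ⊗ g) ⊗ h) (suc k)
      ≡⟨ conv-suc (f ⊗ g) h k ⟩
    (f ⊗ g) 0 * h (suc k) + (tailP (f ⊗ g) ⊗ h) k
      ≡⟨ cong₂ (λ a b → a * h (suc k) + b) (conv-zero f g) (⊗-congˡ h (conv-suc f g) k) ⟩
    (f 0 * g 0) * h (suc k) + (((f 0 ·ₚ tailP g) ⊕ (tailP f ⊗ g)) ⊗ h) k
      ≡⟨ cong (λ x → (f 0 * g 0) * h (suc k) + x) (⊗-distribʳ (f 0 ·ₚ tailP g) (tailP f ⊗ g) h k) ⟩
    (f 0 * g 0) * h (suc k) + (((f 0 ·ₚ tailP g) ⊗ h) k + ((tailP f ⊗ g) ⊗ h) k)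
      ≡⟨ cong₂ (λ a b → (f 0 * g 0) * h (suc k) + (a + b)) (⊗-scalarˡ (f 0) (tailP g) h k) (⊗-assoc (tailP f) g h k) ⟩
    (f 0 * g 0) * h (suc k) + (f 0 * (tailP g ⊗ h) k + (tailP f ⊗ (g ⊗ h)) k)
      ≡⟨ regroup (f 0) (g 0) (h (suc k)) ((tailP g ⊗ h) k) ((tailP f ⊗ (g ⊗ h)) k) ⟩
    f 0 * (g 0 * h (suc k) + (tailP g ⊗ h) k) + (tailP f ⊗ (g ⊗ h)) k
      ≡⟨ cong (λ a → f 0 * a + (tailP f ⊗ (g ⊗ h)) k) (sym (conv-suc g h k)) ⟩
    f 0 * (g ⊗ h) (suc k) + (tailP f ⊗ (g ⊗ h)) k
      ≡⟨ sym (conv-suc f (g ⊗ h) k) ⟩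
    (f ⊗ (g ⊗ h)) (suc k) ∎
    where
    open ≡-Reasoning
    regroup : ∀ a b c d e → (a * b) * c + (a * d + e) ≡ a * (b * c + d) + e
    regroup = solve-∀

  δ : ℕ → Poly
  δ zero    zero    = + 1
  δ zero    (suc k) = + 0
  δ (suc a) zero    = + 0
  δ (suc a) (suc k) = δ a k

  𝟘 : Poly
  𝟘 _ = + 0

  shift : ℕ → Poly → Poly
  shift zero    g         = g
  shift (suc a) g zero    = + 0
  shift (suc a) g (suc k) = shift a g k

  neg : Poly → Poly
  neg f = (- + 1) ·ₚ f

  δ-self : ∀ a → δ a a ≡ + 1
  δ-self zero = refl
  δ-self (suc a) = δ-self a

  𝟘-⊗ : ∀ g → 𝟘 ⊗ g ≗ 𝟘
  𝟘-⊗ g k = sum-zero (suc k) _ (λ i _ → ℤP.*-zeroˡ (g (k ∸ i)))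

  ⊗-𝟘 : ∀ g → g ⊗ 𝟘 ≗ 𝟘
  ⊗-𝟘 g k = trans (⊗-comm g 𝟘 k) (𝟘-⊗ g k)

  δ-⊗ : ∀ a g → δ a ⊗ g ≗ shift a g
  δ-⊗ zero g zero = trans (conv-zero (δ 0) g) (ℤP.*-identityˡ (g 0))
  δ-⊗ zero g (suc k) =
    trans (conv-suc (δ 0) g k) (trans (cong₂ _+_ (ℤP.*-identityˡ (g (suc k))) (𝟘-⊗ g k)) (ℤP.+-identityʳ _))
  δ-⊗ (suc a) g zero = trans (conv-zero (δ (suc a)) g) (ℤP.*-zeroˡ (g 0))
  δ-⊗ (suc a) g (suc k) =
    trans (conv-suc (δ (suc a)) g k) (trans (cong₂ _+_ (ℤP.*-zeroˡ (g (suc k))) (δ-⊗ a g k)) (ℤP.+-identityˡ _))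

  ⊗-δ0 : ∀ g → g ⊗ δ 0 ≗ g
  ⊗-δ0 g k = trans (⊗-comm g (δ 0) k) (δ-⊗ 0 g k)

  shift-ge : ∀ a g k → a ℕ.≤ k → shift a g k ≡ g (k ∸ a)
  shift-ge zero g k _ = refl
  shift-ge (suc a) g (suc k) (ℕ.s≤s le) = shift-ge a g k le

  shift-lt : ∀ a g k → k ℕ.< a → shift a g k ≡ + 0
  shift-lt (suc a) g zero _ = refl
  shift-lt (suc a) g (suc k) (ℕ.s≤s lt) = shift-lt a g k lt

  shift-δ : ∀ a b → shift a (δ b) ≗ δ (a ℕ.+ b)
  shift-δ zero b k = refl
  shift-δ (suc a) b zero = refl
  shift-δ (suc a) b (suc k) = shift-δ a b k

  Xⁿ-1≗ : ∀ n → Xⁿ-1 n ≗ (δ n ⊕ neg (δ 0))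
  Xⁿ-1≗ n k = trans (cong₂ _-_ (indicator n k) (indicator 0 k)) (cong (λ x → δ n k + x) (sym (ℤP.-1*i≡-i (δ 0 k))))
    where
    indicator : ∀ n k → (if (k ℕ.≡ᵇ n) then + 1 else + 0) ≡ δ n k
    indicator zero zero = refl
    indicator zero (suc k) = refl
    indicator (suc n) zero = refl
    indicator (suc n) (suc k) = indicator n k

  Xⁿ-1-⊗ : ∀ n Q → (Xⁿ-1 n ⊗ Q) ≗ (shift n Q ⊕ neg Q)
  Xⁿ-1-⊗ n Q k = begin
    (Xⁿ-1 n ⊗ Q) k                    ≡⟨ ⊗-congˡ Q (Xⁿ-1≗ n) k ⟩
    ((δ n ⊕ neg (δ 0)) ⊗ Q) k         ≡⟨ ⊗-distribʳ (δ n) (neg (δ 0)) Q k ⟩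
    (δ n ⊗ Q) k + (neg (δ 0) ⊗ Q) k   ≡⟨ cong₂ _+_ (δ-⊗ n Q k) (trans (⊗-scalarˡ (- + 1) (δ 0) Q k)
                                                                     (cong ((- + 1) *_) (δ-⊗ 0 Q k))) ⟩
    shift n Q k + (- + 1) * Q k       ∎
    where open ≡-Reasoning

  -- Finitely supported sequences (honest polynomials) are closed under the
  -- ring operations; this is needed whenever a polynomial is used as a witness.

  fs-𝟘 : FinSupp 𝟘
  fs-𝟘 = 0 , λ _ _ → refl

  fs-⊕ : ∀ {f g} → FinSupp f → FinSupp g → FinSupp (f ⊕ g)
  fs-⊕ (a , ha) (b , hb) = a ℕ.⊔ b , λ k le →
    cong₂ _+_ (ha k (ℕP.≤-trans (ℕP.m≤m⊔n a b) le)) (hb k (ℕP.≤-trans (ℕP.m≤n⊔m a b) le))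

  fs-· : ∀ c {f} → FinSupp f → FinSupp (c ·ₚ f)
  fs-· c (a , ha) = a , λ k le → trans (cong (c *_) (ha k le)) (ℤP.*-zeroʳ c)

  fs-⊗ : ∀ {f g} → FinSupp f → FinSupp g → FinSupp (f ⊗ g)
  fs-⊗ {f} {g} (a , ha) (b , hb) = a ℕ.+ b , λ k le → sum-zero (suc k) _ (λ i _ → vanishing k i le)
    where
    vanishing : ∀ k i → a ℕ.+ b ℕ.≤ k → f i * g (k ∸ i) ≡ + 0
    vanishing k i le with a ℕP.≤? i
    ... | yes a≤i = trans (cong (_* g (k ∸ i)) (ha i a≤i)) (ℤP.*-zeroˡ (g (k ∸ i)))
    ... | no a≰i = trans (cong (f i *_) (hb (k ∸ i) b≤k∸i)) (ℤP.*-zeroʳ (f i))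
      where
      b≤k∸i : b ℕ.≤ k ∸ i
      b≤k∸i = ℕP.≤-trans (ℕP.≤-reflexive (sym (ℕP.m+n∸m≡n i b)))
                (ℕP.∸-monoˡ-≤ i (ℕP.≤-trans (ℕP.+-monoˡ-≤ b (ℕP.<⇒≤ (ℕP.≰⇒> a≰i))) le))

  fs-δ : ∀ a → FinSupp (δ a)
  fs-δ a = suc a , vanishing a
    where
    vanishing : ∀ a k → suc a ℕ.≤ k → δ a k ≡ + 0
    vanishing zero (suc k) le = refl
    vanishing (suc a) (suc k) (ℕ.s≤s le) = vanishing a k le

  fs-Xⁿ-1 : ∀ n → FinSupp (Xⁿ-1 n)
  fs-Xⁿ-1 n = suc n , λ k le → trans (Xⁿ-1≗ n k)
    (cong₂ _+_ (proj₂ (fs-δ n) k le) (proj₂ (fs-· (- + 1) (fs-δ 0)) k (ℕP.≤-trans (ℕ.s≤s ℕ.z≤n) le)))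

  fs-Monic : ∀ {f} → Monic f → FinSupp f
  fs-Monic (d , _ , h) = suc d , λ k le → h k le

module Congruence where

  open Polynomials
  open import Data.Nat as ℕ using (ℕ; zero; suc)
  import Data.Nat.Properties as ℕP
  open import Data.Integer using (+_; -_; _+_; _*_; _-_)
  import Data.Integer.Properties as ℤP
  import Data.Integer.Divisibility.Signed as ℤD
  open import Data.Integer.Tactic.RingSolver using (solve-∀)
  open import Data.Product using (∃; _×_; _,_; proj₁; proj₂)
  open import Data.Empty using (⊥-elim)
  open import Relation.Binary.PropositionalEquality
  open import Function using (_$_)

  ≡[]⇒witness : ∀ x q y → x ≡[ q ] y → ∃ λ w → x ≡ y + + q * w
  ≡[]⇒witness x q y d with ℤD.∣ᵤ⇒∣ d
  ... | ℤD.divides w e = w , (begin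
    x             ≡⟨ split x y ⟩
    y + (x - y)   ≡⟨ cong (λ z → y + z) e ⟩
    y + w * + q   ≡⟨ cong (λ z → y + z) (ℤP.*-comm w (+ q)) ⟩
    y + + q * w   ∎)
    where
    open ≡-Reasoning
    split : ∀ x y → x ≡ y + (x - y)
    split = solve-∀

  witness⇒≡[] : ∀ x q y w → x ≡ y + + q * w → x ≡[ q ] y
  witness⇒≡[] x q y w e = ℤD.∣⇒∣ᵤ (ℤD.divides w (begin
    x - y             ≡⟨ cong (_- y) e ⟩
    y + + q * w - y   ≡⟨ cancel y (+ q) w ⟩
    w * + q           ∎))
    where
    open ≡-Reasoning
    cancel : ∀ y q w → y + q * w - y ≡ w * q
    cancel = solve-∀

  *-cancelˡ-pos : ∀ q {x y} → q ≢ 0 → + q * x ≡ + q * y → x ≡ y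
  *-cancelˡ-pos zero q≢0 _ = ⊥-elim (q≢0 refl)
  *-cancelˡ-pos (suc q) {x} {y} _ e = ℤP.*-cancelˡ-≡ (+ suc q) x y e

  *-zero-pos : ∀ q {w} → q ≢ 0 → + q * w ≡ + 0 → w ≡ + 0
  *-zero-pos q q≢0 e = *-cancelˡ-pos q q≢0 (trans e (sym (ℤP.*-zeroʳ (+ q))))

  ≡[]-substˡ : ∀ {x x' q y} → x ≡ x' → x ≡[ q ] y → x' ≡[ q ] y
  ≡[]-substˡ refl h = h

  -- Cong n q P R : P ≡ R in (ℤ/qℤ)[X]/(X^n - 1), witnessed by honest
  -- polynomials W, Q with P = R + q·W + (X^n - 1)·Q.

  record Cong (n q : ℕ) (P R : Poly) : Set where
    constructor mkCong
    field
      witness : ∃ λ W → ∃ λ Q → FinSupp W × FinSupp Q ×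
        (∀ k → P k ≡ R k + (+ q) * W k + (Xⁿ-1 n ⊗ Q) k)

  module CongLaws (n q : ℕ) where

    private
      FX = Xⁿ-1 n

    ≗⇒Cong : ∀ {P R} → P ≗ R → Cong n q P R
    ≗⇒Cong {P} {R} e = mkCong (𝟘 , 𝟘 , fs-𝟘 , fs-𝟘 , λ k →
      trans (e k) (trans (pad (R k) (+ q)) (cong (λ x → R k + (+ q) * + 0 + x) (sym (⊗-𝟘 FX k)))))
      where
      pad : ∀ r q → r ≡ r + q * + 0 + + 0
      pad = solve-∀

    Cong-refl : ∀ {P} → Cong n q P P
    Cong-refl = ≗⇒Cong (λ _ → refl)

    Cong-sym : ∀ {P R} → Cong n q P R → Cong n q R P
    Cong-sym {P} {R} (mkCong (W , Q , fW , fQ , e)) =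
      mkCong $ neg W , neg Q , fs-· (- + 1) fW , fs-· (- + 1) fQ , λ k →
        trans (flip (R k) (+ q) (W k) ((FX ⊗ Q) k))
              (cong₂ (λ a b → a + (+ q) * ((- + 1) * W k) + b) (sym (e k)) (sym (⊗-scalarʳ (- + 1) FX Q k)))
      where
      flip : ∀ r q w x → r ≡ (r + q * w + x) + q * ((- + 1) * w) + (- + 1) * x
      flip = solve-∀

    Cong-trans : ∀ {P R S} → Cong n q P R → Cong n q R S → Cong n q P S
    Cong-trans {P} {R} {S} (mkCong (W , Q , fW , fQ , e)) (mkCong (W' , Q' , fW' , fQ' , e')) =
      mkCong $ (W ⊕ W') , (Q ⊕ Q') , fs-⊕ fW fW' , fs-⊕ fQ fQ' , λ k →
        trans (e k) (trans (cong (λ r → r + (+ q) * W k + (FX ⊗ Q) k) (e' k))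
          (trans (collect (S k) (+ q) (W k) (W' k) ((FX ⊗ Q) k) ((FX ⊗ Q') k))
                 (cong (λ x → S k + (+ q) * (W k + W' k) + x) (sym (⊗-distribˡ FX Q Q' k)))))
      where
      collect : ∀ s q w w' x x' → s + q * w' + x' + q * w + x ≡ s + q * (w + w') + (x + x')
      collect = solve-∀

    Cong-+ : ∀ {P R P' R'} → Cong n q P R → Cong n q P' R' → Cong n q (P ⊕ P') (R ⊕ R')
    Cong-+ {P} {R} {P'} {R'} (mkCong (W , Q , fW , fQ , e)) (mkCong (W' , Q' , fW' , fQ' , e')) =
      mkCong $ (W ⊕ W') , (Q ⊕ Q') , fs-⊕ fW fW' , fs-⊕ fQ fQ' , λ k →
        trans (cong₂ _+_ (e k) (e' k))
          (trans (collect (R k) (R' k) (+ q) (W k) (W' k) ((FX ⊗ Q) k) ((FX ⊗ Q') k))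
                 (cong (λ x → R k + R' k + (+ q) * (W k + W' k) + x) (sym (⊗-distribˡ FX Q Q' k))))
      where
      collect : ∀ r r' q w w' x x' → (r + q * w + x) + (r' + q * w' + x') ≡ (r + r') + q * (w + w') + (x + x')
      collect = solve-∀

    Cong-neg : ∀ {P R} → Cong n q P R → Cong n q (neg P) (neg R)
    Cong-neg {P} {R} (mkCong (W , Q , fW , fQ , e)) =
      mkCong $ neg W , neg Q , fs-· (- + 1) fW , fs-· (- + 1) fQ , λ k →
        trans (cong ((- + 1) *_) (e k))
          (trans (distribute (R k) (+ q) (W k) ((FX ⊗ Q) k))
                 (cong (λ x → (- + 1) * R k + (+ q) * ((- + 1) * W k) + x) (sym (⊗-scalarʳ (- + 1) FX Q k))))
      where
      distribute : ∀ r q w x → (- + 1) * (r + q * w + x) ≡ (- + 1) * r + q * ((- + 1) * w) + (- + 1) * x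
      distribute = solve-∀

    Cong-*ʳ : ∀ {P R} X → FinSupp X → Cong n q P R → Cong n q (P ⊗ X) (R ⊗ X)
    Cong-*ʳ {P} {R} X fX (mkCong (W , Q , fW , fQ , e)) =
      mkCong $ (W ⊗ X) , (Q ⊗ X) , fs-⊗ fW fX , fs-⊗ fQ fX , λ k → begin
        (P ⊗ X) k
          ≡⟨ ⊗-congˡ X e k ⟩
        (((R ⊕ ((+ q) ·ₚ W)) ⊕ (FX ⊗ Q)) ⊗ X) k
          ≡⟨ ⊗-distribʳ (R ⊕ ((+ q) ·ₚ W)) (FX ⊗ Q) X k ⟩
        ((R ⊕ ((+ q) ·ₚ W)) ⊗ X) k + ((FX ⊗ Q) ⊗ X) k
          ≡⟨ cong₂ _+_ (⊗-distribʳ R ((+ q) ·ₚ W) X k) (⊗-assoc FX Q X k) ⟩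
        ((R ⊗ X) k + (((+ q) ·ₚ W) ⊗ X) k) + (FX ⊗ (Q ⊗ X)) k
          ≡⟨ cong (λ a → ((R ⊗ X) k + a) + (FX ⊗ (Q ⊗ X)) k) (⊗-scalarˡ (+ q) W X k) ⟩
        (R ⊗ X) k + (+ q) * (W ⊗ X) k + (FX ⊗ (Q ⊗ X)) k ∎
      where open ≡-Reasoning

    Cong-*ˡ : ∀ {P R} X → FinSupp X → Cong n q P R → Cong n q (X ⊗ P) (X ⊗ R)
    Cong-*ˡ {P} {R} X fX c =
      Cong-trans (≗⇒Cong (⊗-comm X P)) (Cong-trans (Cong-*ʳ X fX c) (≗⇒Cong (⊗-comm R X)))

    Cong-q≈0 : Cong n q ((+ q) ·ₚ δ 0) 𝟘
    Cong-q≈0 = mkCong (δ 0 , 𝟘 , fs-δ 0 , fs-𝟘 , λ k →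
      trans (pad (+ q) (δ 0 k)) (cong (λ z → + 0 + + q * δ 0 k + z) (sym (⊗-𝟘 (Xⁿ-1 n) k))))
      where
      pad : ∀ q x → q * x ≡ + 0 + q * x + + 0
      pad = solve-∀

  exactify : ∀ q {P R} → q ≢ 0 → FinSupp P → FinSupp R → P ≡ₚ[ q ] R →
    ∃ λ T → FinSupp T × (∀ k → P k ≡ R k + + q * T k)
  exactify q {P} {R} q≢0 (dP , hP) (dR , hR) h = T , (dP ℕ.⊔ dR , vanishing) , λ k → proj₂ (wit k)
    where
    wit : ∀ k → ∃ λ w → P k ≡ R k + + q * w
    wit k = ≡[]⇒witness (P k) q (R k) (h k)
    T : Poly
    T k = proj₁ (wit k)
    vanishing : ∀ k → dP ℕ.⊔ dR ℕ.≤ k → T k ≡ + 0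
    vanishing k le = *-zero-pos q q≢0 (begin
      + q * T k          ≡⟨ sym (ℤP.+-identityˡ _) ⟩
      + 0 + + q * T k    ≡⟨ cong (λ z → z + + q * T k) (sym (hR k (ℕP.≤-trans (ℕP.m≤n⊔m dP dR) le))) ⟩
      R k + + q * T k    ≡⟨ sym (proj₂ (wit k)) ⟩
      P k                ≡⟨ hP k (ℕP.≤-trans (ℕP.m≤m⊔n dP dR) le) ⟩
      + 0                ∎)
      where open ≡-Reasoning

  exact⇒Cong : ∀ n q {P R T} → FinSupp T → (∀ k → P k ≡ R k + + q * T k) → Cong n q P R
  exact⇒Cong n q {P} {R} {T} fT h = mkCong (T , 𝟘 , fT , fs-𝟘 , λ k →
    trans (h k) (trans (sym (ℤP.+-identityʳ _)) (cong (λ z → R k + + q * T k + z) (sym (⊗-𝟘 (Xⁿ-1 n) k)))))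

  ≡ₚ⇒Cong : ∀ n q {P R Q} → q ≢ 0 → FinSupp P → FinSupp R → FinSupp Q →
    P ≡ₚ[ q ] (R ⊕ (Xⁿ-1 n ⊗ Q)) → Cong n q P R
  ≡ₚ⇒Cong n q {P} {R} {Q} q≢0 fP fR fQ h with exactify q q≢0 fP (fs-⊕ fR (fs-⊗ (fs-Xⁿ-1 n) fQ)) h
  ... | T , fT , e = mkCong (T , Q , fT , fQ , λ k → trans (e k) (swap (R k) _ (+ q) (T k)))
    where
    swap : ∀ r x q w → r + x + q * w ≡ r + q * w + x
    swap = solve-∀

  Cong⇒≡ₚ : ∀ n q {P R} → Cong n q P R → ∃ λ Q → FinSupp Q × (P ≡ₚ[ q ] (R ⊕ (Xⁿ-1 n ⊗ Q)))
  Cong⇒≡ₚ n q {P} {R} (mkCong (W , Q , fW , fQ , e)) = Q , fQ , λ k →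
    witness⇒≡[] (P k) q ((R ⊕ (Xⁿ-1 n ⊗ Q)) k) (W k) (trans (e k) (swap (R k) _ (+ q) (W k)))
    where
    swap : ∀ r x q w → r + q * w + x ≡ r + x + q * w
    swap = solve-∀

  Cong-≡-modulus : ∀ {n q q' P R} → q ≡ q' → Cong n q P R → Cong n q' P R
  Cong-≡-modulus refl c = c

  Cong-weaken : ∀ n a b {P R} → Cong n (a ℕ.* b) P R → Cong n a P R
  Cong-weaken n a b {P} {R} (mkCong (W , Q , fW , fQ , e)) = mkCong (((+ b) ·ₚ W) , Q , fs-· (+ b) fW , fQ , λ k →
    trans (e k) (cong (λ z → R k + z + (Xⁿ-1 n ⊗ Q) k) (trans (cong (_* W k) (ℤP.pos-* a b)) (ℤP.*-assoc (+ a) (+ b) (W k)))))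

  Cong-lift : ∀ n p q {P R} → Cong n p P R → ∃ λ W → FinSupp W × Cong n q P (R ⊕ ((+ p) ·ₚ W))
  Cong-lift n p q {P} {R} (mkCong (W , Q , fW , fQ , e)) = W , fW , mkCong (𝟘 , Q , fs-𝟘 , fQ , λ k →
    trans (e k) (pad (R k) (+ p) (W k) (+ q) _))
    where
    pad : ∀ r p w q x → r + p * w + x ≡ r + p * w + q * + 0 + x
    pad = solve-∀

  ≗Xⁿ-1⇒Cong : ∀ n q {P R Q} → FinSupp Q → P ≗ (R ⊕ (Xⁿ-1 n ⊗ Q)) → Cong n q P R
  ≗Xⁿ-1⇒Cong n q {P} {R} {Q} fQ e = mkCong (𝟘 , Q , fs-𝟘 , fQ , λ k → trans (e k) (pad (R k) (+ q) _))
    where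
    pad : ∀ r q x → r + x ≡ r + q * + 0 + x
    pad = solve-∀

module Words where

  open Polynomials
  open Congruence
  open import Data.Nat as ℕ using (ℕ; zero; suc; _∸_)
  import Data.Nat.Properties as ℕP
  open import Data.Nat.Induction using (<-rec)
  open import Data.Integer using (ℤ; +_; -_; _+_; _*_; _-_)
  import Data.Integer.Properties as ℤP
  open import Data.Integer.Tactic.RingSolver using (solve-∀)
  open import Data.Fin using (Fin; toℕ; fromℕ<)
  import Data.Fin.Properties as FinP
  open import Data.Product using (∃; _×_; _,_; proj₁; proj₂)
  open import Data.Sum using (inj₁; inj₂)
  open import Data.Empty using (⊥-elim)
  open import Relation.Nullary using (yes; no)
  open import Relation.Binary.PropositionalEquality

  fs-toPoly : ∀ n c → FinSupp (toPoly n c)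
  fs-toPoly n c = n , vanishing
    where
    vanishing : ∀ k → n ℕ.≤ k → toPoly n c k ≡ + 0
    vanishing k le with k ℕP.<? n
    ... | yes k<n = ⊥-elim (ℕP.<⇒≱ k<n le)
    ... | no _ = refl

  toPoly-lt : ∀ n c k (k<n : k ℕ.< n) → toPoly n c k ≡ c (fromℕ< k<n)
  toPoly-lt n c k k<n with k ℕP.<? n
  ... | yes k<n' = cong c (FinP.fromℕ<-cong k k refl k<n' k<n)
  ... | no k≮n = ⊥-elim (k≮n k<n)

  toPoly-scale : ∀ n (c c' : Fin n → ℤ) a → (∀ i → c i ≡ a * c' i) → toPoly n c ≗ (a ·ₚ toPoly n c')
  toPoly-scale n c c' a h k with k ℕP.<? n
  ... | yes k<n = h (fromℕ< k<n)
  ... | no _ = sym (ℤP.*-zeroʳ a)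

  -- By induction on a degree bound d: a top
  -- coefficient P_{d} with d ≥ n is moved down to X^{d-n}.
  reduce-to-word : ∀ n → 1 ℕ.≤ n → ∀ d P → (∀ k → d ℕ.≤ k → P k ≡ + 0) →
    ∃ λ (c : Fin n → ℤ) → ∃ λ Q → FinSupp Q × (P ≗ (toPoly n c ⊕ (Xⁿ-1 n ⊗ Q)))
  reduce-to-word n 1≤n d P hP with d ℕP.≤? n
  ... | yes d≤n = (λ i → P (toℕ i)) , 𝟘 , fs-𝟘 , λ k →
    trans (restrict k) (sym (trans (cong (λ z → toPoly n (λ i → P (toℕ i)) k + z) (⊗-𝟘 (Xⁿ-1 n) k)) (ℤP.+-identityʳ _)))
    where
    restrict : ∀ k → P k ≡ toPoly n (λ i → P (toℕ i)) k
    restrict k with ℕP.≤-<-connex n k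
    ... | inj₂ k<n = trans (cong P (sym (FinP.toℕ-fromℕ< k<n))) (sym (toPoly-lt n (λ i → P (toℕ i)) k k<n))
    ... | inj₁ n≤k = trans (hP k (ℕP.≤-trans d≤n n≤k)) (sym (proj₂ (fs-toPoly n _) k n≤k))
  reduce-to-word n 1≤n zero P hP | no 0≰n = ⊥-elim (0≰n ℕ.z≤n)
  reduce-to-word n 1≤n (suc d) P hP | no sd≰n with reduce-to-word n 1≤n d moveDown moveDown-bound
    where
    n≤d : n ℕ.≤ d
    n≤d = ℕP.≤-pred (ℕP.≰⇒> sd≰n)
    d∸n<d : d ∸ n ℕ.< d
    d∸n<d = ℕP.∸-monoʳ-< {d} {n} {0} 1≤n n≤d
    -- P - P_d X^d + P_d X^{d-n}, which has degree < d
    moveDown : Poly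
    moveDown = (P ⊕ ((- P d) ·ₚ δ d)) ⊕ (P d ·ₚ δ (d ∸ n))
    moveDown-bound : ∀ k → d ℕ.≤ k → moveDown k ≡ + 0
    moveDown-bound k le with ℕP.m≤n⇒m<n∨m≡n le
    ... | inj₁ d<k = trans (cong₂ _+_ (cong₂ _+_ (hP k d<k) (cong (- P d *_) (proj₂ (fs-δ d) k d<k)))
                                     (cong (P d *_) (proj₂ (fs-δ (d ∸ n)) k (ℕP.<-trans d∸n<d d<k))))
                           (vanish (- P d) (P d))
      where
      vanish : ∀ u v → + 0 + u * + 0 + v * + 0 ≡ + 0
      vanish = solve-∀
    ... | inj₂ refl = trans (cong₂ (λ u v → P d + - P d * u + P d * v) (δ-self d) (proj₂ (fs-δ (d ∸ n)) d d∸n<d))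
                            (vanish (P d))
      where
      vanish : ∀ x → x + - x * + 1 + x * + 0 ≡ + 0
      vanish = solve-∀
  ... | c , Q' , fQ' , e = c , (Q' ⊕ (P d ·ₚ δ a)) , fs-⊕ fQ' (fs-· (P d) (fs-δ a)) , λ k → begin
      P k
        ≡⟨ split (P k) (P d) (δ d k) (δ a k) ⟩
      (P k + (- P d) * δ d k + P d * δ a k) + P d * (δ d k + (- + 1) * δ a k)
        ≡⟨ cong₂ _+_ (e k) (cong (λ z → P d * (δ z k + (- + 1) * δ a k)) (sym (ℕP.m+[n∸m]≡n n≤d))) ⟩
      (toPoly n c k + (Xⁿ-1 n ⊗ Q') k) + P d * (δ (n ℕ.+ a) k + (- + 1) * δ a k)
        ≡⟨ cong (λ z → (toPoly n c k + (Xⁿ-1 n ⊗ Q') k) + P d * z) (sym (Xⁿ-1-δ k)) ⟩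
      (toPoly n c k + (Xⁿ-1 n ⊗ Q') k) + P d * (Xⁿ-1 n ⊗ δ a) k
        ≡⟨ cong (λ z → (toPoly n c k + (Xⁿ-1 n ⊗ Q') k) + z) (sym (⊗-scalarʳ (P d) (Xⁿ-1 n) (δ a) k)) ⟩
      (toPoly n c k + (Xⁿ-1 n ⊗ Q') k) + (Xⁿ-1 n ⊗ (P d ·ₚ δ a)) k
        ≡⟨ ℤP.+-assoc (toPoly n c k) _ _ ⟩
      toPoly n c k + ((Xⁿ-1 n ⊗ Q') k + (Xⁿ-1 n ⊗ (P d ·ₚ δ a)) k)
        ≡⟨ cong (λ z → toPoly n c k + z) (sym (⊗-distribˡ (Xⁿ-1 n) Q' (P d ·ₚ δ a) k)) ⟩
      toPoly n c k + (Xⁿ-1 n ⊗ (Q' ⊕ (P d ·ₚ δ a))) k ∎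
    where
    open ≡-Reasoning
    n≤d : n ℕ.≤ d
    n≤d = ℕP.≤-pred (ℕP.≰⇒> sd≰n)
    a = d ∸ n
    Xⁿ-1-δ : (Xⁿ-1 n ⊗ δ a) ≗ (δ (n ℕ.+ a) ⊕ neg (δ a))
    Xⁿ-1-δ k = trans (Xⁿ-1-⊗ n (δ a) k) (cong (_+ (- + 1) * δ a k) (shift-δ n a k))
    split : ∀ x s u v → x ≡ (x + (- s) * u + s * v) + s * (u + (- + 1) * v)
    split = solve-∀

  -- Multiplication by the monic X^n - 1 reflects divisibility of coefficients:
  -- if a divides every coefficient of (X^n - 1)·Q, it divides every
  -- coefficient of Q (strong induction, using Q_k = Q_{k-n} - ((X^n-1)Q)_k).
  Xⁿ-1-reflects-divisibility : ∀ n a Q → 1 ℕ.≤ n →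
    (∀ k → ∃ λ v → (Xⁿ-1 n ⊗ Q) k ≡ + a * v) → ∀ k → ∃ λ u → Q k ≡ + a * u
  Xⁿ-1-reflects-divisibility n a Q 1≤n divides = <-rec (λ k → ∃ λ u → Q k ≡ + a * u) step
    where
    coefficient : ∀ k → Q k ≡ shift n Q k - (Xⁿ-1 n ⊗ Q) k
    coefficient k = trans (rearrange (Q k) (shift n Q k)) (cong (λ z → shift n Q k - z) (sym (Xⁿ-1-⊗ n Q k)))
      where
      rearrange : ∀ q s → q ≡ s - (s + (- + 1) * q)
      rearrange = solve-∀
    step : ∀ k → (∀ {j} → j ℕ.< k → ∃ λ u → Q j ≡ + a * u) → ∃ λ u → Q k ≡ + a * u
    step k rec with divides k | n ℕP.≤? k
    ... | v , ev | yes n≤k with rec {k ∸ n} (ℕP.∸-monoʳ-< {k} {n} {0} 1≤n n≤k)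
    ...   | u , eu = u - v , (begin
      Q k                          ≡⟨ coefficient k ⟩
      shift n Q k - (Xⁿ-1 n ⊗ Q) k ≡⟨ cong₂ _-_ (trans (shift-ge n Q k n≤k) eu) ev ⟩
      + a * u - + a * v            ≡⟨ factor (+ a) u v ⟩
      + a * (u - v)                ∎)
      where
      open ≡-Reasoning
      factor : ∀ a u v → a * u - a * v ≡ a * (u - v)
      factor = solve-∀
    step k rec | v , ev | no n≰k = - v , (begin
      Q k                          ≡⟨ coefficient k ⟩
      shift n Q k - (Xⁿ-1 n ⊗ Q) k ≡⟨ cong₂ _-_ (shift-lt n Q k (ℕP.≰⇒> n≰k)) ev ⟩
      + 0 - + a * v                ≡⟨ negate (+ a) v ⟩
      + a * (- v)                  ∎)
      where
      open ≡-Reasoning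
      negate : ∀ a v → + 0 - a * v ≡ a * (- v)
      negate = solve-∀

  Cong-cancel : ∀ n a b {P} → 1 ℕ.≤ n → a ≢ 0 → Cong n (a ℕ.* b) ((+ a) ·ₚ P) 𝟘 → Cong n b P 𝟘
  Cong-cancel n a b {P} 1≤n a≢0 (mkCong (W , Q , fW , fQ , e)) = mkCong (W , Q' , fW , fQ' , cancelled)
    where
    FX = Xⁿ-1 n
    FX⊗Q-divisible : ∀ k → ∃ λ v → (FX ⊗ Q) k ≡ + a * v
    FX⊗Q-divisible k = P k - + b * W k , (begin
      (FX ⊗ Q) k                                      ≡⟨ isolate (+ a) (+ b) (W k) _ ⟩
      (+ 0 + + a * + b * W k + (FX ⊗ Q) k) - + a * + b * W k
        ≡⟨ cong (λ z → z - + a * + b * W k) (sym (trans (e k) (cong (λ z → + 0 + z * W k + (FX ⊗ Q) k) (ℤP.pos-* a b)))) ⟩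
      + a * P k - + a * + b * W k                     ≡⟨ factor (+ a) (P k) (+ b) (W k) ⟩
      + a * (P k - + b * W k)                         ∎)
      where
      open ≡-Reasoning
      isolate : ∀ a b w x → x ≡ (+ 0 + a * b * w + x) - a * b * w
      isolate = solve-∀
      factor : ∀ a p b w → a * p - a * b * w ≡ a * (p - b * w)
      factor = solve-∀
    Q-divisible = Xⁿ-1-reflects-divisibility n a Q 1≤n FX⊗Q-divisible
    Q' : Poly
    Q' k = proj₁ (Q-divisible k)
    fQ' : FinSupp Q'
    fQ' = proj₁ fQ , λ k le → *-zero-pos a a≢0 (trans (sym (proj₂ (Q-divisible k))) (proj₂ fQ k le))
    cancelled : ∀ k → P k ≡ + 0 + + b * W k + (FX ⊗ Q') k
    cancelled k = *-cancelˡ-pos a a≢0 (begin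
      + a * P k
        ≡⟨ e k ⟩
      + 0 + + (a ℕ.* b) * W k + (FX ⊗ Q) k
        ≡⟨ cong₂ (λ z y → + 0 + z * W k + y) (ℤP.pos-* a b) (⊗-congʳ FX (λ j → proj₂ (Q-divisible j)) k) ⟩
      + 0 + + a * + b * W k + (FX ⊗ ((+ a) ·ₚ Q')) k
        ≡⟨ cong (λ z → + 0 + + a * + b * W k + z) (⊗-scalarʳ (+ a) FX Q' k) ⟩
      + 0 + + a * + b * W k + + a * (FX ⊗ Q') k
        ≡⟨ factor (+ a) (+ b) (W k) _ ⟩
      + a * (+ 0 + + b * W k + (FX ⊗ Q') k) ∎)
      where
      open ≡-Reasoning
      factor : ∀ a b w x → + 0 + a * b * w + a * x ≡ a * (+ 0 + b * w + x)
      factor = solve-∀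

module Bezout where

  open Polynomials
  open Congruence
  open import Data.Nat as ℕ using (ℕ; zero; suc; _^_)
  open import Data.Nat.Divisibility as ℕD using ()
  open import Data.Nat.Coprimality using (Coprime; coprime-Bézout; coprime-divisor)
  open import Data.Nat.GCD using (module Bézout)
  open import Data.Integer using (ℤ; +_; -_; _+_; _*_; _-_)
  import Data.Integer.Properties as ℤP
  open import Data.Integer.Tactic.RingSolver using (solve-∀)
  open import Data.Product using (∃; _,_)
  open import Relation.Binary.PropositionalEquality

  coprime-* : ∀ {a b c} → Coprime a b → Coprime a c → Coprime a (b ℕ.* c)
  coprime-* {a} {b} {c} a⊥b a⊥c (d∣a , d∣bc) = a⊥c (d∣a , coprime-divisor d⊥b d∣bc)
    where
    d⊥b : Coprime _ b
    d⊥b (e∣d , e∣b) = a⊥b (ℕD.∣-trans e∣d d∣a , e∣b)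

  coprime-^ : ∀ {a b} → Coprime a b → ∀ k → Coprime a (b ^ k)
  coprime-^ a⊥b zero (_ , d∣1) = ℕD.∣1⇒≡1 d∣1
  coprime-^ a⊥b (suc k) = coprime-* a⊥b (coprime-^ a⊥b k)

  inverse-mod : ∀ n q → Coprime n q → ∃ λ ν → ∃ λ μ → ν * + n ≡ + 1 + + q * μ
  inverse-mod n q n⊥q with coprime-Bézout n⊥q
  ... | Bézout.+- x y eq = + x , + y , (begin
    + x * + n            ≡⟨ sym (ℤP.pos-* x n) ⟩
    + (x ℕ.* n)          ≡⟨ cong +_ (sym eq) ⟩
    + (1 ℕ.+ y ℕ.* q)    ≡⟨ cong (λ z → + 1 + z) (trans (ℤP.pos-* y q) (ℤP.*-comm (+ y) (+ q))) ⟩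
    + 1 + + q * + y      ∎)
    where open ≡-Reasoning
  ... | Bézout.-+ x y eq = - + x , - + y , (begin
    - + x * + n                                           ≡⟨ expand (+ x) (+ n) (+ y) (+ q) ⟩
    + 1 + + q * (- + y) + (+ y * + q - (+ 1 + + x * + n)) ≡⟨ cong (λ z → + 1 + + q * (- + y) + (+ y * + q - z)) identity ⟩
    + 1 + + q * (- + y) + (+ y * + q - + y * + q)         ≡⟨ cancel (+ 1 + + q * (- + y)) (+ y * + q) ⟩
    + 1 + + q * (- + y)                                   ∎)
    where
    open ≡-Reasoning
    identity : + 1 + + x * + n ≡ + y * + q
    identity = trans (cong (λ z → + 1 + z) (sym (ℤP.pos-* x n))) (trans (cong +_ eq) (ℤP.pos-* y q))
    expand : ∀ x n y q → - x * n ≡ + 1 + q * (- y) + (y * q - (+ 1 + x * n))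
    expand = solve-∀
    cancel : ∀ a b → a + (b - b) ≡ a
    cancel = solve-∀

  -- The Euler operator E f = X·f', i.e. (E f)_k = k·f_k.  It is a derivation.

  E : Poly → Poly
  E f k = + k * f k

  fs-E : ∀ {f} → FinSupp f → FinSupp (E f)
  fs-E (d , h) = d , λ k le → trans (cong (+ k *_) (h k le)) (ℤP.*-zeroʳ (+ k))

  +suc* : ∀ j x → + suc j * x ≡ x + + j * x
  +suc* j x = trans (cong (_* x) (ℤP.pos-+ 1 j)) (trans (ℤP.*-distribʳ-+ x (+ 1) (+ j)) (cong (_+ + j * x) (ℤP.*-identityˡ x)))

  E-⊗ : ∀ f g k → E (f ⊗ g) k ≡ (E f ⊗ g) k + (f ⊗ E g) k
  E-⊗ f g zero = begin
    + 0 * (f ⊗ g) 0                           ≡⟨ ℤP.*-zeroˡ ((f ⊗ g) 0) ⟩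
    + 0                                       ≡⟨ zeros (f 0) (g 0) ⟩
    (+ 0 * f 0) * g 0 + f 0 * (+ 0 * g 0)     ≡⟨ sym (cong₂ _+_ (conv-zero (E f) g) (conv-zero f (E g))) ⟩
    (E f ⊗ g) 0 + (f ⊗ E g) 0                 ∎
    where
    open ≡-Reasoning
    zeros : ∀ a b → + 0 ≡ (+ 0 * a) * b + a * (+ 0 * b)
    zeros = solve-∀
  E-⊗ f g (suc k) = begin
    + suc k * (f ⊗ g) (suc k)
      ≡⟨ cong (+ suc k *_) (conv-suc f g k) ⟩
    + suc k * (a * b + t)
      ≡⟨ +suc* k _ ⟩
    (a * b + t) + + k * (a * b + t)
      ≡⟨ distrib a b t (+ k) ⟩
    (a * b + t) + + k * (a * b) + + k * t
      ≡⟨ cong (λ z → (a * b + t) + + k * (a * b) + z) (E-⊗ (tailP f) g k) ⟩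
    (a * b + t) + + k * (a * b) + ((E (tailP f) ⊗ g) k + (tailP f ⊗ E g) k)
      ≡⟨ regroup a b t (+ k) _ _ ⟩
    (+ 0 * a * b + (t + (E (tailP f) ⊗ g) k)) + (a * (b + + k * b) + (tailP f ⊗ E g) k)
      ≡⟨ cong₂ (λ u v → (+ 0 * a * b + u) + (a * v + (tailP f ⊗ E g) k))
               (sym (⊗-distribʳ (tailP f) (E (tailP f)) g k)) (sym (+suc* k b)) ⟩
    (+ 0 * a * b + ((tailP f ⊕ E (tailP f)) ⊗ g) k) + (a * E g (suc k) + (tailP f ⊗ E g) k)
      ≡⟨ cong (λ u → (+ 0 * a * b + u) + (a * E g (suc k) + (tailP f ⊗ E g) k))
              (⊗-congˡ g (λ j → sym (+suc* j (f (suc j)))) k) ⟩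
    (E f 0 * g (suc k) + (tailP (E f) ⊗ g) k) + (f 0 * E g (suc k) + (tailP f ⊗ E g) k)
      ≡⟨ sym (cong₂ _+_ (conv-suc (E f) g k) (conv-suc f (E g) k)) ⟩
    (E f ⊗ g) (suc k) + (f ⊗ E g) (suc k) ∎
    where
    open ≡-Reasoning
    a = f 0
    b = g (suc k)
    t = (tailP f ⊗ g) k
    distrib : ∀ a b t kk → (a * b + t) + kk * (a * b + t) ≡ (a * b + t) + kk * (a * b) + kk * t
    distrib = solve-∀
    regroup : ∀ a b t kk u v → (a * b + t) + kk * (a * b) + (u + v) ≡ (+ 0 * a * b + (t + u)) + (a * (b + kk * b) + v)
    regroup = solve-∀

  δ-E : ∀ a k → + k * δ a k ≡ + a * δ a k
  δ-E zero zero = refl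
  δ-E zero (suc k) = trans (ℤP.*-zeroʳ (+ suc k)) (sym (ℤP.*-zeroʳ (+ 0)))
  δ-E (suc a) zero = trans (ℤP.*-zeroˡ (+ 0)) (sym (ℤP.*-zeroʳ (+ suc a)))
  δ-E (suc a) (suc k) = trans (+suc* k (δ a k)) (trans (cong (λ z → δ a k + z) (δ-E a k)) (sym (+suc* a (δ a k))))

  E-Xⁿ-1 : ∀ n k → E (Xⁿ-1 n) k + (- + n) * Xⁿ-1 n k ≡ + n * δ 0 k
  E-Xⁿ-1 n k = begin
    + k * Xⁿ-1 n k + (- + n) * Xⁿ-1 n k
      ≡⟨ cong₂ (λ u v → + k * u + (- + n) * v) (Xⁿ-1≗ n k) (Xⁿ-1≗ n k) ⟩
    + k * (δ n k + (- + 1) * δ 0 k) + (- + n) * (δ n k + (- + 1) * δ 0 k)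
      ≡⟨ expand (+ k) (+ n) (δ n k) (δ 0 k) ⟩
    + k * δ n k + (- + 1) * (+ k * δ 0 k) + (- + n) * δ n k + + n * δ 0 k
      ≡⟨ cong₂ (λ u v → u + (- + 1) * v + (- + n) * δ n k + + n * δ 0 k)
               (δ-E n k) (trans (δ-E 0 k) (ℤP.*-zeroˡ (δ 0 k))) ⟩
    + n * δ n k + (- + 1) * + 0 + (- + n) * δ n k + + n * δ 0 k
      ≡⟨ cancel (+ n) (δ n k) (δ 0 k) ⟩
    + n * δ 0 k ∎
    where
    open ≡-Reasoning
    expand : ∀ kk nn x y → kk * (x + (- + 1) * y) + (- nn) * (x + (- + 1) * y) ≡ kk * x + (- + 1) * (kk * y) + (- nn) * x + nn * y
    expand = solve-∀
    cancel : ∀ nn x y → nn * x + (- + 1) * + 0 + (- nn) * x + nn * y ≡ nn * y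
    cancel = solve-∀

  -- Bézout identity for a factorisation of X^n - 1 modulo q when n is a unit
  -- mod q: if G·H = (X^n - 1) + q·T and ν·n ≡ 1 (mod q), then with
  -- A = ν·(E H - n·H) and B = ν·E G we have A·G + B·H = ν·(E - n)(G·H),
  -- which is ≡ ν·n ≡ 1 modulo (q, X^n - 1).
  module FactorBezout (n q : ℕ) (G H T : Poly) (ν μ : ℤ)
    (G⊗H≡ : ∀ k → (G ⊗ H) k ≡ Xⁿ-1 n k + + q * T k) (fT : FinSupp T) (νn≡ : ν * + n ≡ + 1 + + q * μ) where

    A B : Poly
    A = ν ·ₚ (E H ⊕ ((- + n) ·ₚ H))
    B = ν ·ₚ E G

    fs-A : FinSupp H → FinSupp A
    fs-A fH = fs-· ν (fs-⊕ (fs-E fH) (fs-· (- + n) fH))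

    fs-B : FinSupp G → FinSupp B
    fs-B fG = fs-· ν (fs-E fG)

    combination : ∀ k → ((A ⊗ G) ⊕ (B ⊗ H)) k ≡ ν * (E (G ⊗ H) k + (- + n) * (G ⊗ H) k)
    combination k = begin
      (A ⊗ G) k + (B ⊗ H) k
        ≡⟨ cong₂ _+_ (trans (⊗-scalarˡ ν _ G k) (cong (ν *_) (trans (⊗-distribʳ (E H) _ G k)
                       (cong₂ _+_ (⊗-comm (E H) G k) (trans (⊗-scalarˡ (- + n) H G k) (cong ((- + n) *_) (⊗-comm H G k)))))))
                     (⊗-scalarˡ ν (E G) H k) ⟩
      ν * ((G ⊗ E H) k + (- + n) * (G ⊗ H) k) + ν * (E G ⊗ H) k
        ≡⟨ collect ν ((E G ⊗ H) k) ((G ⊗ E H) k) ((G ⊗ H) k) (+ n) ⟩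
      ν * (((E G ⊗ H) k + (G ⊗ E H) k) + (- + n) * (G ⊗ H) k)
        ≡⟨ cong (λ z → ν * (z + (- + n) * (G ⊗ H) k)) (sym (E-⊗ G H k)) ⟩
      ν * (E (G ⊗ H) k + (- + n) * (G ⊗ H) k) ∎
      where
      open ≡-Reasoning
      collect : ∀ ν a1 a2 gh nn → ν * (a2 + (- nn) * gh) + ν * a1 ≡ ν * ((a1 + a2) + (- nn) * gh)
      collect = solve-∀

    bezout : Cong n q ((A ⊗ G) ⊕ (B ⊗ H)) (δ 0)
    bezout = exact⇒Cong n q fW λ k → begin
      ((A ⊗ G) ⊕ (B ⊗ H)) k
        ≡⟨ combination k ⟩
      ν * (+ k * (G ⊗ H) k + (- + n) * (G ⊗ H) k)
        ≡⟨ cong (λ z → ν * (+ k * z + (- + n) * z)) (G⊗H≡ k) ⟩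
      ν * (+ k * (Xⁿ-1 n k + + q * T k) + (- + n) * (Xⁿ-1 n k + + q * T k))
        ≡⟨ expand ν (+ k) (+ n) (Xⁿ-1 n k) (+ q) (T k) ⟩
      ν * (E (Xⁿ-1 n) k + (- + n) * Xⁿ-1 n k) + + q * (ν * (E T k + (- + n) * T k))
        ≡⟨ cong (λ z → ν * z + + q * (ν * (E T k + (- + n) * T k))) (E-Xⁿ-1 n k) ⟩
      ν * (+ n * δ 0 k) + + q * (ν * (E T k + (- + n) * T k))
        ≡⟨ cong (_+ + q * (ν * (E T k + (- + n) * T k))) (trans (sym (ℤP.*-assoc ν (+ n) (δ 0 k))) (cong (_* δ 0 k) νn≡)) ⟩
      (+ 1 + + q * μ) * δ 0 k + + q * (ν * (E T k + (- + n) * T k))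
        ≡⟨ collect (+ q) μ (δ 0 k) _ ⟩
      δ 0 k + + q * W k ∎
      where
      open ≡-Reasoning
      expand : ∀ ν kk nn x qq t → ν * (kk * (x + qq * t) + (- nn) * (x + qq * t))
                                 ≡ ν * (kk * x + (- nn) * x) + qq * (ν * (kk * t + (- nn) * t))
      expand = solve-∀
      collect : ∀ qq μ d w → (+ 1 + qq * μ) * d + qq * w ≡ d + qq * (μ * d + w)
      collect = solve-∀
      W : Poly
      W k = μ * δ 0 k + ν * (E T k + (- + n) * T k)
      fW : FinSupp W
      fW = fs-⊕ (fs-· μ (fs-δ 0)) (fs-· ν (fs-⊕ (fs-E fT) (fs-· (- + n) fT)))

-- The ring (ℤ/qℤ)[X]/(X^n - 1): honest polynomials modulo Cong n q,
-- packaged as a CommutativeRing so that general ring facts apply to it.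
module QuotientRing (n q : ℕ) where

  open Polynomials
  open Congruence
  open import Data.Integer using (ℤ; +_; -_; _+_; _*_)
  import Data.Integer.Properties as ℤP
  open import Data.Integer.Tactic.RingSolver using (solve-∀)
  open import Data.Product using (_,_)
  open import Relation.Binary.PropositionalEquality using (_≡_; _≗_; cong; trans)
  open import Level using (0ℓ)
  open import Algebra.Bundles using (CommutativeRing)
  open import Algebra.Structures using (IsCommutativeRing)

  open CongLaws n q

  -- An element is an honest polynomial.  El has no eta rule and its
  -- operations are defined by copatterns, so that ring expressions stay
  -- folded during unification.
  record El : Set where
    no-eta-equality
    constructor elem
    field
      poly    : Poly
      support : FinSupp poly

  open El public

  infix  4 _≈_
  infixl 6 _+ᵉ_
  infixl 7 _*ᵉ_

  -- a record, so that both sides can be inferred from an equation a ≈ b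
  record _≈_ (a b : El) : Set where
    constructor by-Cong
    field to-Cong : Cong n q (poly a) (poly b)

  open _≈_ public

  _+ᵉ_ : El → El → El
  poly    (a +ᵉ b) = poly a ⊕ poly b
  support (a +ᵉ b) = fs-⊕ (support a) (support b)

  _*ᵉ_ : El → El → El
  poly    (a *ᵉ b) = poly a ⊗ poly b
  support (a *ᵉ b) = fs-⊗ (support a) (support b)

  -ᵉ_ : El → El
  poly    (-ᵉ a) = neg (poly a)
  support (-ᵉ a) = fs-· (- + 1) (support a)

  0ᵉ 1ᵉ : El
  0ᵉ = elem 𝟘 fs-𝟘
  1ᵉ = elem (δ 0) (fs-δ 0)

  scalar : ℤ → El
  scalar c = elem (c ·ₚ δ 0) (fs-· c (fs-δ 0))

  pointwise : ∀ {a b : El} → poly a ≗ poly b → a ≈ b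
  pointwise e = by-Cong (≗⇒Cong e)

  isCommutativeRing : IsCommutativeRing _≈_ _+ᵉ_ _*ᵉ_ -ᵉ_ 0ᵉ 1ᵉ
  isCommutativeRing = record
    { isRing = record
      { +-isAbelianGroup = record
        { isGroup = record
          { isMonoid = record
            { isSemigroup = record
              { isMagma = record
                { isEquivalence = record
                    { refl = by-Cong Cong-refl
                    ; sym = λ x≈y → by-Cong (Cong-sym (to-Cong x≈y))
                    ; trans = λ x≈y y≈z → by-Cong (Cong-trans (to-Cong x≈y) (to-Cong y≈z)) }
                ; ∙-cong = λ x≈y u≈v → by-Cong (Cong-+ (to-Cong x≈y) (to-Cong u≈v)) }
              ; assoc = λ a b c → pointwise {(a +ᵉ b) +ᵉ c} {a +ᵉ (b +ᵉ c)}
                          (λ k → ℤP.+-assoc (poly a k) (poly b k) (poly c k)) }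
            ; identity = (λ a → pointwise {0ᵉ +ᵉ a} {a} (λ k → ℤP.+-identityˡ (poly a k)))
                       , (λ a → pointwise {a +ᵉ 0ᵉ} {a} (λ k → ℤP.+-identityʳ (poly a k))) }
          ; inverse = (λ a → pointwise {(-ᵉ a) +ᵉ a} {0ᵉ} (λ k → inverseˡ (poly a k)))
                    , (λ a → pointwise {a +ᵉ (-ᵉ a)} {0ᵉ} (λ k → inverseʳ (poly a k)))
          ; ⁻¹-cong = λ x≈y → by-Cong (Cong-neg (to-Cong x≈y)) }
        ; comm = λ a b → pointwise {a +ᵉ b} {b +ᵉ a} (λ k → ℤP.+-comm (poly a k) (poly b k)) }
      ; *-cong = λ {x} {y} {u} {v} x≈y u≈v →
          by-Cong (Cong-trans (Cong-*ʳ (poly u) (support u) (to-Cong x≈y)) (Cong-*ˡ (poly y) (support y) (to-Cong u≈v)))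
      ; *-assoc = λ a b c → pointwise {(a *ᵉ b) *ᵉ c} {a *ᵉ (b *ᵉ c)} (⊗-assoc (poly a) (poly b) (poly c))
      ; *-identity = (λ a → pointwise {1ᵉ *ᵉ a} {a} (δ-⊗ 0 (poly a)))
                   , (λ a → pointwise {a *ᵉ 1ᵉ} {a} (⊗-δ0 (poly a)))
      ; distrib = (λ a b c → pointwise {a *ᵉ (b +ᵉ c)} {(a *ᵉ b) +ᵉ (a *ᵉ c)} (⊗-distribˡ (poly a) (poly b) (poly c)))
                , (λ a b c → pointwise {(b +ᵉ c) *ᵉ a} {(b *ᵉ a) +ᵉ (c *ᵉ a)} (⊗-distribʳ (poly b) (poly c) (poly a))) }
    ; *-comm = λ a b → pointwise {a *ᵉ b} {b *ᵉ a} (⊗-comm (poly a) (poly b)) }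
    where
    inverseˡ : ∀ x → (- + 1) * x + x ≡ + 0
    inverseˡ = solve-∀
    inverseʳ : ∀ x → x + (- + 1) * x ≡ + 0
    inverseʳ = solve-∀

  ring : CommutativeRing 0ℓ 0ℓ
  ring = record { isCommutativeRing = isCommutativeRing }

  scalar-* : ∀ c (x : El) → poly (scalar c *ᵉ x) ≗ (c ·ₚ poly x)
  scalar-* c x k = trans (⊗-scalarˡ c (δ 0) (poly x) k) (cong (c *_) (δ-⊗ 0 (poly x) k))

module RingFacts {c ℓ} (R : CommutativeRing c ℓ) where

  open import Data.Nat using (ℕ; zero; suc)
  import Relation.Binary.Reasoning.Setoid as SetoidReasoning

  open CommutativeRing R
  open import Algebra.Solver.Ring.NaturalCoefficients.Default commutativeSemiring using (solve; _:=_; _:+_; _:*_)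
  open SetoidReasoning setoid

  pow : Carrier → ℕ → Carrier
  pow x zero    = 1#
  pow x (suc k) = x * pow x k

  absorb : ∀ x y w → y ≈ 0# → x + y * w ≈ x
  absorb x y w y≈0 = begin
    x + y * w   ≈⟨ +-congˡ (*-congʳ y≈0) ⟩
    x + 0# * w  ≈⟨ +-congˡ (zeroˡ w) ⟩
    x + 0#      ≈⟨ +-identityʳ x ⟩
    x           ∎

  nilpotent-fixed-point : ∀ x P s m → x ≈ (P * s) * x → pow P m ≈ 0# → x ≈ 0#
  nilpotent-fixed-point x P s m fixed Pᵐ≈0 = begin
    x                          ≈⟨ iterate m ⟩
    pow P m * (pow s m * x)    ≈⟨ *-congʳ Pᵐ≈0 ⟩
    0# * (pow s m * x)         ≈⟨ zeroˡ _ ⟩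
    0#                         ∎
    where
    regroup : ∀ P s Y Z x → (P * s) * (Y * (Z * x)) ≈ (P * Y) * ((s * Z) * x)
    regroup = solve 5 (λ P s Y Z x → (P :* s) :* (Y :* (Z :* x)) := (P :* Y) :* ((s :* Z) :* x)) refl
    iterate : ∀ k → x ≈ pow P k * (pow s k * x)
    iterate zero = sym (trans (*-identityˡ _) (*-identityˡ x))
    iterate (suc k) = begin
      x                                   ≈⟨ fixed ⟩
      (P * s) * x                         ≈⟨ *-congˡ (iterate k) ⟩
      (P * s) * (pow P k * (pow s k * x)) ≈⟨ regroup P s (pow P k) (pow s k) x ⟩
      pow P (suc k) * (pow s (suc k) * x) ∎

  -- Then g·h' ≈ 0: x = g·h' satisfies x ≈ a·g·x (by Bézout, as g·h ≈ 0) and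
  -- x ≈ P·w·h' (as g'·h' ≈ 0), hence x ≈ (P·a·w)·x.
  orthogonal-lift : ∀ g h a b g' h' k P w m →
    a * g + b * h ≈ 1# → g * h ≈ 0# → g ≈ g' * k + P * w → g' * h' ≈ 0# → pow P m ≈ 0# →
    g * h' ≈ 0#
  orthogonal-lift g h a b g' h' k P w m bezout g·h≈0 g≈ g'·h'≈0 Pᵐ≈0 =
    nilpotent-fixed-point (g * h') P (a * w) m fixed Pᵐ≈0
    where
    x : Carrier
    x = g * h'
    expand₁ : ∀ g h' a b h → (g * h') * (a * g + b * h) ≈ (a * g) * (g * h') + (g * h) * (h' * b)
    expand₁ = solve 5 (λ g h' a b h → (g :* h') :* (a :* g :+ b :* h) := (a :* g) :* (g :* h') :+ (g :* h) :* (h' :* b)) refl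
    expand₂ : ∀ g' k P w h' → (g' * k + P * w) * h' ≈ P * (w * h') + (g' * h') * k
    expand₂ = solve 5 (λ g' k P w h' → (g' :* k :+ P :* w) :* h' := P :* (w :* h') :+ (g' :* h') :* k) refl
    regroup : ∀ a g P w h' → (a * g) * (P * (w * h')) ≈ (P * (a * w)) * (g * h')
    regroup = solve 5 (λ a g P w h' → (a :* g) :* (P :* (w :* h')) := (P :* (a :* w)) :* (g :* h')) refl
    x≈agx : x ≈ (a * g) * x
    x≈agx = begin
      x                                     ≈⟨ sym (*-identityʳ x) ⟩
      x * 1#                                ≈⟨ *-congˡ (sym bezout) ⟩
      x * (a * g + b * h)                   ≈⟨ expand₁ g h' a b h ⟩
      (a * g) * x + (g * h) * (h' * b)      ≈⟨ absorb ((a * g) * x) (g * h) (h' * b) g·h≈0 ⟩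
      (a * g) * x                           ∎
    x≈Pwh' : x ≈ P * (w * h')
    x≈Pwh' = begin
      x                                     ≈⟨ *-congʳ g≈ ⟩
      (g' * k + P * w) * h'                 ≈⟨ expand₂ g' k P w h' ⟩
      P * (w * h') + (g' * h') * k          ≈⟨ absorb (P * (w * h')) (g' * h') k g'·h'≈0 ⟩
      P * (w * h')                          ∎
    fixed : x ≈ (P * (a * w)) * x
    fixed = begin
      x                                     ≈⟨ x≈agx ⟩
      (a * g) * x                           ≈⟨ *-congˡ x≈Pwh' ⟩
      (a * g) * (P * (w * h'))              ≈⟨ regroup a g P w h' ⟩
      (P * (a * w)) * x                     ∎

  multiple-orthogonal : ∀ e g c f b h → e ≈ c * g → g * h ≈ 0# → (e * f) * (b * h) ≈ 0#
  multiple-orthogonal e g c f b h e≈cg g·h≈0 = begin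
    (e * f) * (b * h)         ≈⟨ *-congʳ (*-congʳ e≈cg) ⟩
    ((c * g) * f) * (b * h)   ≈⟨ regroup c g f b h ⟩
    (g * h) * ((c * f) * b)   ≈⟨ *-congʳ g·h≈0 ⟩
    0# * ((c * f) * b)        ≈⟨ zeroˡ _ ⟩
    0#                        ∎
    where
    regroup : ∀ c g f b h → ((c * g) * f) * (b * h) ≈ (g * h) * ((c * f) * b)
    regroup = solve 5 (λ c g f b h → ((c :* g) :* f) :* (b :* h) := (g :* h) :* ((c :* f) :* b)) refl

module Norms where

  open import Data.Nat as ℕ using (ℕ; zero; suc)
  open import Data.Nat.Divisibility as ℕD using ()
  open import Data.Nat.Coprimality using (Coprime)
  open import Data.Integer as ℤ using (ℤ; +_; -[1+_]; +[1+_]; _+_; _*_)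
  import Data.Integer.Properties as ℤP
  open import Data.Integer.Tactic.RingSolver using (solve-∀)
  open import Data.Rational as ℚ using (ℚ; mkℚ; 1ℚ)
  import Data.Rational.Properties as ℚP
  open import Data.Fin as Fin using (Fin; fromℕ; inject₁)
  open import Data.Empty using (⊥-elim)
  open import Data.Product using (_,_)
  open import Function using (_∘_)
  open import Relation.Binary.PropositionalEquality

  private
    coprime-1 : ∀ x → Coprime x 1
    coprime-1 x (_ , d∣1) = ℕD.∣1⇒≡1 d∣1

    ι : ℤ → ℚ
    ι z = mkℚ z 0 (coprime-1 _)

    toℚ≡ι : ∀ z → toℚ z ≡ ι z
    toℚ≡ι (+ n) = ℚP.normalize-coprime (coprime-1 n)
    toℚ≡ι -[1+ n ] = cong ℚ.-_ (ℚP.normalize-coprime (coprime-1 (suc n)))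

  toℚ-* : ∀ a b → toℚ a ℚ.* toℚ b ≡ toℚ (a * b)
  toℚ-* a b rewrite toℚ≡ι a | toℚ≡ι b = refl

  toℚ-mono : ∀ {a b} → a ℤ.≤ b → toℚ a ℚ.≤ toℚ b
  toℚ-mono {a} {b} le rewrite toℚ≡ι a | toℚ≡ι b =
    ℚ.*≤* (subst₂ ℤ._≤_ (sym (ℤP.*-identityʳ a)) (sym (ℤP.*-identityʳ b)) le)

  scale-bound : ∀ (γ : ℚ) (A B : ℕ) (S' : ℤ) → toℚ (+ A) ℚ.≤ γ ℚ.* toℚ S' →
    toℚ (+ (B ℕ.* A)) ℚ.≤ γ ℚ.* toℚ (+ B * S')
  scale-bound γ A B S' h = begin
    toℚ (+ (B ℕ.* A))                 ≡⟨ cong toℚ (ℤP.pos-* B A) ⟩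
    toℚ (+ B * + A)                   ≡⟨ sym (toℚ-* (+ B) (+ A)) ⟩
    toℚ (+ B) ℚ.* toℚ (+ A)           ≤⟨ multiply h ⟩
    toℚ (+ B) ℚ.* (γ ℚ.* toℚ S')      ≡⟨ sym (ℚP.*-assoc (toℚ (+ B)) γ (toℚ S')) ⟩
    (toℚ (+ B) ℚ.* γ) ℚ.* toℚ S'      ≡⟨ cong (ℚ._* toℚ S') (ℚP.*-comm (toℚ (+ B)) γ) ⟩
    (γ ℚ.* toℚ (+ B)) ℚ.* toℚ S'      ≡⟨ ℚP.*-assoc γ (toℚ (+ B)) (toℚ S') ⟩
    γ ℚ.* (toℚ (+ B) ℚ.* toℚ S')      ≡⟨ cong (γ ℚ.*_) (toℚ-* (+ B) S') ⟩
    γ ℚ.* toℚ (+ B * S')              ∎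
    where
    open ℚP.≤-Reasoning
    multiply : ∀ {x y} → x ℚ.≤ y → toℚ (+ B) ℚ.* x ℚ.≤ toℚ (+ B) ℚ.* y
    multiply le rewrite toℚ≡ι (+ B) = ℚP.*-monoˡ-≤-nonNeg (ι (+ B)) {{_}} le

  γ-bound : ∀ (γ : ℚ) (P : ℕ) (S : ℤ) → 1ℚ ℚ.≤ γ → + P ℤ.≤ S → toℚ (+ P) ℚ.≤ γ ℚ.* toℚ S
  γ-bound γ P S 1≤γ le = begin
    toℚ (+ P)          ≤⟨ toℚ-mono le ⟩
    toℚ S              ≡⟨ sym (ℚP.*-identityˡ (toℚ S)) ⟩
    1ℚ ℚ.* toℚ S       ≤⟨ multiply S (ℤP.≤-trans (ℤ.+≤+ ℕ.z≤n) le) 1≤γ ⟩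
    γ ℚ.* toℚ S        ∎
    where
    open ℚP.≤-Reasoning
    multiply : ∀ S → + 0 ℤ.≤ S → ∀ {x y} → x ℚ.≤ y → x ℚ.* toℚ S ℚ.≤ y ℚ.* toℚ S
    multiply (+ s) _ le rewrite toℚ≡ι (+ s) = ℚP.*-monoʳ-≤-nonNeg (ι (+ s)) {{_}} le

  sumFin-scale : ∀ N (a a' : Fin N → ℤ) c → (∀ k → a k ≡ c * a' k) → sumFin N a ≡ c * sumFin N a'
  sumFin-scale zero a a' c h = sym (ℤP.*-zeroʳ c)
  sumFin-scale (suc N) a a' c h =
    trans (cong₂ _+_ (sumFin-scale N (a ∘ inject₁) (a' ∘ inject₁) c (h ∘ inject₁)) (h (fromℕ N)))
          (sym (ℤP.*-distribˡ-+ c _ _))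

  sqNorm-scale : ∀ N (a a' : Fin N → ℤ) c → (∀ k → a k ≡ c * a' k) → sqNorm N a ≡ (c * c) * sqNorm N a'
  sqNorm-scale N a a' c h = sumFin-scale N _ _ (c * c) (λ k → trans (cong₂ _*_ (h k) (h k)) (square c (a' k)))
    where
    square : ∀ c x → (c * x) * (c * x) ≡ (c * c) * (x * x)
    square = solve-∀

  square-nonneg : ∀ x → + 0 ℤ.≤ x * x
  square-nonneg (+ n) = subst (+ 0 ℤ.≤_) (ℤP.pos-* n n) (ℤ.+≤+ ℕ.z≤n)
  square-nonneg -[1+ n ] = ℤ.+≤+ ℕ.z≤n

  square-pos : ∀ x → x ≢ + 0 → + 1 ℤ.≤ x * x
  square-pos (+ zero) x≢0 = ⊥-elim (x≢0 refl)
  square-pos +[1+ n ] _ = ℤ.+≤+ (ℕ.s≤s ℕ.z≤n)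
  square-pos -[1+ n ] _ = ℤ.+≤+ (ℕ.s≤s ℕ.z≤n)

  sqNorm-nonneg : ∀ N a → + 0 ℤ.≤ sqNorm N a
  sqNorm-nonneg zero a = ℤP.≤-refl
  sqNorm-nonneg (suc N) a = ℤP.+-mono-≤ (sqNorm-nonneg N (λ i → a (inject₁ i))) (square-nonneg (a (fromℕ N)))

  -- Every index of Fin (suc N) is either the last one or an injected one,
  -- matching the recursion of sumFin.
  data LastView : ∀ {N} → Fin (suc N) → Set where
    last     : ∀ {N} → LastView (fromℕ N)
    injected : ∀ {N} (k : Fin N) → LastView (inject₁ k)

  lastView : ∀ {N} (k : Fin (suc N)) → LastView k
  lastView {zero} Fin.zero = last
  lastView {suc N} Fin.zero = injected Fin.zero
  lastView {suc N} (Fin.suc k) with lastView k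
  ... | last = last
  ... | injected k' = injected (Fin.suc k')

  sqNorm-≥-coordinate : ∀ N a k → a k * a k ℤ.≤ sqNorm N a
  sqNorm-≥-coordinate (suc N) a k with lastView k
  ... | last = ℤP.≤-trans (ℤP.≤-reflexive (sym (ℤP.+-identityˡ _)))
                          (ℤP.+-monoˡ-≤ (a (fromℕ N) * a (fromℕ N)) (sqNorm-nonneg N (λ i → a (inject₁ i))))
  ... | injected k' = ℤP.≤-trans (sqNorm-≥-coordinate N (λ i → a (inject₁ i)) k')
                          (ℤP.≤-trans (ℤP.≤-reflexive (sym (ℤP.+-identityʳ _)))
                                      (ℤP.+-monoʳ-≤ (sqNorm N (λ i → a (inject₁ i))) (square-nonneg (a (fromℕ N)))))

module Codes where

  open Polynomials
  open Congruence
  open Words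
  open Norms using (sumFin-scale)
  open import Data.Nat as ℕ using (ℕ)
  open import Data.Integer using (ℤ; +_; -_; _+_; _*_)
  import Data.Integer.Properties as ℤP
  open import Data.Integer.Tactic.RingSolver using (solve-∀)
  open import Data.Fin using (Fin; fromℕ; inject₁)
  open import Data.Product using (∃; _×_; _,_)
  open import Function using (_∘_)
  open import Relation.Binary.PropositionalEquality

  CyclicCode⇒Cong : ∀ p n g c → p ≢ 0 → FinSupp g → CyclicCode p n g c →
    ∃ λ F → FinSupp F × Cong n p (g ⊗ F) (toPoly n c)
  CyclicCode⇒Cong p n g c p≢0 fg (F , fF , Q , fQ , h) = F 0 , fF 0 ,
    ≡ₚ⇒Cong n p p≢0 (fs-⊗ fg (fF 0)) (fs-toPoly n c) fQ (λ k → ≡[]-substˡ (ℤP.+-identityˡ ((g ⊗ F 0) k)) (h k))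

  Cong⇒CyclicCode : ∀ p n g c F → FinSupp F → Cong n p (toPoly n c) (g ⊗ F) → CyclicCode p n g c
  Cong⇒CyclicCode p n g c F fF c≡gF with Cong⇒≡ₚ n p (CongLaws.Cong-sym n p c≡gF)
  ... | Q , fQ , h = (λ _ → F) , (λ _ → fF) , Q , fQ , λ k → ≡[]-substˡ (sym (ℤP.+-identityˡ ((g ⊗ F) k))) (h k)

  ≡[]-weaken : ∀ {x y} a b → x ≡[ a ℕ.* b ] y → x ≡[ a ] y
  ≡[]-weaken {x} {y} a b h with ≡[]⇒witness x (a ℕ.* b) y h
  ... | w , e = witness⇒≡[] x a y (+ b * w)
    (trans e (cong (λ z → y + z) (trans (cong (_* w) (ℤP.pos-* a b)) (ℤP.*-assoc (+ a) (+ b) w))))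

  ≡[]-divide : ∀ d e {x y} → d ≢ 0 → + d * x ≡[ d ℕ.* e ] + d * y → x ≡[ e ] y
  ≡[]-divide d e {x} {y} d≢0 h with ≡[]⇒witness (+ d * x) (d ℕ.* e) (+ d * y) h
  ... | w , eq = witness⇒≡[] x e y w (*-cancelˡ-pos d d≢0 (begin
    + d * x                          ≡⟨ eq ⟩
    + d * y + + (d ℕ.* e) * w        ≡⟨ cong (λ z → + d * y + z * w) (ℤP.pos-* d e) ⟩
    + d * y + + d * + e * w          ≡⟨ factor (+ d) y (+ e) w ⟩
    + d * (y + + e * w)              ∎))
    where
    open ≡-Reasoning
    factor : ∀ d y e w → d * y + d * e * w ≡ d * (y + e * w)
    factor = solve-∀

  divide-extended : ∀ n p d r (Ĉ C : (Fin n → ℤ) → Set) → d ≢ 0 →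
    (∀ c c' → Ĉ c → (∀ k → c k ≡ + d * c' k) → C c') →
    ∀ a a' → Extended (d ℕ.* (p ℕ.* r)) n Ĉ a → (∀ k → a k ≡ + d * a' k) → Extended p n C a'
  divide-extended n p d r Ĉ C d≢0 divide a a' (a∈Ĉ , parity) a≡da' =
    divide (a ∘ inject₁) (a' ∘ inject₁) a∈Ĉ (a≡da' ∘ inject₁) ,
    ≡[]-weaken {a' (fromℕ n)} {parity'} p r (≡[]-divide d (p ℕ.* r) {a' (fromℕ n)} {parity'} d≢0
      (subst₂ (λ u v → u ≡[ d ℕ.* (p ℕ.* r) ] v) (a≡da' (fromℕ n)) scaled-sum parity))
    where
    parity' : ℤ
    parity' = - sumFin n (a' ∘ inject₁)
    scaled-sum : - sumFin n (a ∘ inject₁) ≡ + d * parity'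
    scaled-sum = trans (cong -_ (sumFin-scale n _ _ (+ d) (a≡da' ∘ inject₁)))
                       (ℤP.neg-distribʳ-* (+ d) (sumFin n (a' ∘ inject₁)))

module ValuationBound where

  open Congruence using (≡[]⇒witness)
  open Norms
  open import Data.Nat as ℕ using (ℕ; zero; suc; _∸_; _^_)
  import Data.Nat.Properties as ℕP
  open import Data.Integer as ℤ using (ℤ; +_; _+_; _*_)
  import Data.Integer.Properties as ℤP
  import Data.Integer.Divisibility.Signed as ℤD
  open import Data.Integer.Tactic.RingSolver using (solve-∀)
  open import Data.Rational as ℚ using (ℚ; 1ℚ)
  open import Data.Fin using (Fin)
  import Data.Fin.Properties as FinP
  open import Data.Product using (∃; _,_; proj₁; proj₂)
  open import Relation.Nullary using (¬_; yes; no)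
  open import Relation.Binary.PropositionalEquality

  divide : ∀ {N} d (a : Fin N → ℤ) → (∀ k → + d ℤD.∣ a k) → ∃ λ a' → ∀ k → a k ≡ + d * a' k
  divide d a d∣a = (λ k → ℤD.quotient (d∣a k)) , λ k → trans (ℤD._∣_.equality (d∣a k)) (ℤP.*-comm _ (+ d))

  multiple-norm : ∀ N d (a a' : Fin N → ℤ) → (∀ k → a k ≡ + d * a' k) → ¬ (∀ k → a k ≡ + 0) →
    + (d ℕ.* d) ℤ.≤ sqNorm N a
  multiple-norm N d a a' a≡da' a≢0 = begin
    + (d ℕ.* d)                        ≡⟨ sym (ℤP.*-identityʳ _) ⟩
    + (d ℕ.* d) * + 1                  ≤⟨ ℤP.*-monoˡ-≤-nonNeg (+ (d ℕ.* d)) a'-norm ⟩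
    + (d ℕ.* d) * sqNorm N a'          ≡⟨ sym (norm-scaled N d a a' a≡da') ⟩
    sqNorm N a                         ∎
    where
    open ℤP.≤-Reasoning
    nonzero = FinP.¬∀⟶∃¬ N (λ k → a k ≡ + 0) (λ k → a k ℤ.≟ + 0) a≢0
    a'-nonzero : a' (proj₁ nonzero) ≢ + 0
    a'-nonzero e = proj₂ nonzero (trans (a≡da' _) (trans (cong (+ d *_) e) (ℤP.*-zeroʳ (+ d))))
    a'-norm : + 1 ℤ.≤ sqNorm N a'
    a'-norm = ℤP.≤-trans (square-pos _ a'-nonzero) (sqNorm-≥-coordinate N a' (proj₁ nonzero))
    norm-scaled : ∀ N d (a a' : Fin N → ℤ) → (∀ k → a k ≡ + d * a' k) → sqNorm N a ≡ + (d ℕ.* d) * sqNorm N a'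
    norm-scaled N d a a' h = trans (sqNorm-scale N a a' (+ d) h) (cong (_* sqNorm N a') (sym (ℤP.pos-* d d)))

  power-split : ∀ p m t → t ℕ.≤ m → (p ^ t ℕ.* p ^ t) ℕ.* p ^ (2 ℕ.* m ∸ 2 ℕ.* t) ≡ p ^ m ℕ.* p ^ m
  power-split p m t t≤m = begin
    (p ^ t ℕ.* p ^ t) ℕ.* p ^ (2 ℕ.* m ∸ 2 ℕ.* t) ≡⟨ cong (ℕ._* p ^ (2 ℕ.* m ∸ 2 ℕ.* t)) (sym (square t)) ⟩
    p ^ (2 ℕ.* t) ℕ.* p ^ (2 ℕ.* m ∸ 2 ℕ.* t)     ≡⟨ sym (ℕP.^-distribˡ-+-* p (2 ℕ.* t) _) ⟩
    p ^ (2 ℕ.* t ℕ.+ (2 ℕ.* m ∸ 2 ℕ.* t))         ≡⟨ cong (p ^_) (ℕP.m+[n∸m]≡n (ℕP.*-monoʳ-≤ 2 t≤m)) ⟩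
    p ^ (2 ℕ.* m)                                 ≡⟨ square m ⟩
    p ^ m ℕ.* p ^ m                               ∎
    where
    open ≡-Reasoning
    square : ∀ x → p ^ (2 ℕ.* x) ≡ p ^ x ℕ.* p ^ x
    square x = trans (ℕP.^-distribˡ-+-* p x (1 ℕ.* x)) (cong (λ z → p ^ x ℕ.* p ^ z) (ℕP.*-identityˡ x))

  -- Proof: let t be the p-adic valuation of a
  -- (capped at m).  If t = m then Σa_i² ≥ p^{2m}; otherwise a = p^t·a' with
  -- a' ≢ 0 mod p, so Σa_i² = p^{2t}·Σa'_i² ≥ p^{2t}·p^{2m-2t}/γ.
  layered-minimum : ∀ p m N (L : (Fin N → ℤ) → Set) (C : ℕ → (Fin N → ℤ) → Set) (γ : ℚ) → 1ℚ ℚ.≤ γ →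
    (∀ t → t ℕ.< m → ∀ a a' → L a → (∀ k → a k ≡ + (p ^ t) * a' k) → C t a') →
    (∀ t → t ℕ.< m → DistE≥ p N (C t) (p ^ (2 ℕ.* m ∸ 2 ℕ.* t)) γ) →
    MinLattice≥ p m N L (p ^ m) γ
  layered-minimum p m N L C γ 1≤γ layer dist a a∈L a≢0 =
    descend m 0 (ℕP.+-identityʳ m) (λ k → ℤD.divides (a k) (sym (ℤP.*-identityʳ (a k))))
    where
    -- invariant: p^t divides a, and s more divisions are allowed before t = m
    descend : ∀ s t → s ℕ.+ t ≡ m → (∀ k → + (p ^ t) ℤD.∣ a k) →
      toℚ (+ (p ^ m ℕ.* p ^ m)) ℚ.≤ γ ℚ.* toℚ (sqNorm N a)
    descend zero t refl pᵗ∣a with divide (p ^ t) a pᵗ∣a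
    ... | a' , a≡pᵗa' = γ-bound γ _ _ 1≤γ (multiple-norm N (p ^ t) a a' a≡pᵗa' a≢0)
    descend (suc s) t s+1+t≡m pᵗ∣a with FinP.all? (λ k → + (p ^ suc t) ℤD.∣? a k)
    ... | yes pᵗ⁺¹∣a = descend s (suc t) (trans (ℕP.+-suc s t) s+1+t≡m) pᵗ⁺¹∣a
    ... | no pᵗ⁺¹∤a with divide (p ^ t) a pᵗ∣a
    ...   | a' , a≡pᵗa' =
      subst₂ (λ u v → toℚ (+ u) ℚ.≤ γ ℚ.* toℚ v) (power-split p m t (ℕP.<⇒≤ t<m)) (sym norm-a)
        (scale-bound γ _ (p ^ t ℕ.* p ^ t) (sqNorm N a') (dist t t<m a' (layer t t<m a a' a∈L a≡pᵗa') a'≢0))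
      where
      t<m : t ℕ.< m
      t<m = subst (t ℕ.<_) s+1+t≡m (ℕ.s≤s (ℕP.m≤n+m t s))
      norm-a : sqNorm N a ≡ + (p ^ t ℕ.* p ^ t) * sqNorm N a'
      norm-a = trans (sqNorm-scale N a a' (+ (p ^ t)) a≡pᵗa') (cong (_* sqNorm N a') (sym (ℤP.pos-* (p ^ t) (p ^ t))))
      -- if a' ≡ 0 mod p then p^{t+1} would divide a
      a'≢0 : ¬ (∀ k → a' k ≡[ p ] + 0)
      a'≢0 a'≡0 with FinP.¬∀⟶∃¬ N _ (λ k → + (p ^ suc t) ℤD.∣? a k) pᵗ⁺¹∤a
      ... | k , pᵗ⁺¹∤aₖ with ≡[]⇒witness (a' k) p (+ 0) (a'≡0 k)
      ...   | w , a'ₖ≡pw = pᵗ⁺¹∤aₖ (ℤD.divides w (begin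
        a k                           ≡⟨ a≡pᵗa' k ⟩
        + (p ^ t) * a' k              ≡⟨ cong (+ (p ^ t) *_) a'ₖ≡pw ⟩
        + (p ^ t) * (+ 0 + + p * w)   ≡⟨ rearrange (+ (p ^ t)) (+ p) w ⟩
        w * (+ p * + (p ^ t))         ≡⟨ cong (w *_) (sym (ℤP.pos-* p (p ^ t))) ⟩
        w * + (p ^ suc t)             ∎))
        where
        open ≡-Reasoning
        rearrange : ∀ c p w → c * (+ 0 + p * w) ≡ w * (p * c)
        rearrange = solve-∀

module LiftedChain (p : ℕ) (p-prime : Prime p) (m : ℕ) (1≤m : 1 ≤ m) (n : ℕ) (1≤n : 1 ≤ n) (p∤n : ¬ (p ∣ n))
  (g G : ℕ → Poly)
  (g-generator : ∀ j → j < m → IsGenerator p n (g j))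
  (G-lift : ∀ j → j < m → IsHenselLift p m n (g j) (G j))
  (chain : ∀ j → suc j < m → ∀ c → CyclicCode p n (g j) c → CyclicCode p n (g (suc j)) c) where

  open Polynomials
  open Congruence
  open Words
  open Bezout
  open Codes
  open import Data.Nat as ℕ using (zero; _∸_; _^_)
  import Data.Nat.Properties as ℕP
  open import Data.Nat.Coprimality using (Coprime)
  open import Data.Nat.Primality using (prime⇒irreducible; prime⇒nonZero)
  open import Data.Integer using (ℤ; +_; _+_; _*_)
  import Data.Integer.Properties as ℤP
  open import Data.Integer.Tactic.RingSolver using (solve-∀)
  open import Data.Fin using (Fin)
  open import Data.Product using (∃; _×_; _,_; proj₁; proj₂)
  open import Data.Sum using (inj₁; inj₂)
  open import Data.Empty using (⊥-elim)
  open import Relation.Nullary using (Dec; yes; no)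
  open import Relation.Binary.PropositionalEquality
  open import Algebra.Bundles using (CommutativeRing)
  import Relation.Binary.Reasoning.Setoid as SetoidReasoning

  q : ℕ
  q = p ^ m

  p≢0 : p ≢ 0
  p≢0 = ℕ.≢-nonZero⁻¹ p {{prime⇒nonZero p-prime}}

  pᵏ≢0 : ∀ k → p ^ k ≢ 0
  pᵏ≢0 k e = p≢0 (ℕP.m^n≡0⇒m≡0 p k e)

  q-split : ∀ a → a ℕ.≤ m → q ≡ p ^ a ℕ.* p ^ (m ∸ a)
  q-split a a≤m = trans (cong (p ^_) (sym (ℕP.m+[n∸m]≡n a≤m))) (ℕP.^-distribˡ-+-* p a (m ∸ a))

  -- Since p ∤ n, n is a unit modulo q = p^m: ν·n = 1 + q·μ.
  n-unit : ∃ λ ν → ∃ λ μ → ν * + n ≡ + 1 + + q * μ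
  n-unit = inverse-mod n q (coprime-^ n⊥p m)
    where
    n⊥p : Coprime n p
    n⊥p (d∣n , d∣p) with prime⇒irreducible p-prime d∣p
    ... | inj₁ d≡1 = d≡1
    ... | inj₂ refl = ⊥-elim (p∤n d∣n)

  open QuotientRing n q
    using (El; elem; poly; support; _≈_; by-Cong; to-Cong; _+ᵉ_; _*ᵉ_; 0ᵉ; 1ᵉ; scalar; scalar-*; pointwise; ring)
  open CommutativeRing ring using (*-congˡ; *-congʳ; +-cong; zeroˡ; zeroʳ; distribˡ; distribʳ)
    renaming (sym to ≈-sym; trans to ≈-trans)
  open RingFacts ring using (pow; orthogonal-lift; multiple-orthogonal)

  module Factor (j : ℕ) (j<m : j < m) where

    fs-G : FinSupp (G j)
    fs-G = fs-Monic (proj₁ (G-lift j j<m))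

    fs-g : FinSupp (g j)
    fs-g = fs-Monic (proj₁ (g-generator j j<m))

    G≡g : Cong n p (G j) (g j)
    G≡g with exactify p p≢0 fs-G fs-g (proj₂ (proj₂ (G-lift j j<m)))
    ... | T , fT , e = exact⇒Cong n p fT e

    H : Poly
    H = proj₁ (proj₁ (proj₂ (G-lift j j<m)))

    fs-H : FinSupp H
    fs-H = proj₁ (proj₂ (proj₁ (proj₂ (G-lift j j<m))))

    factorisation : ∃ λ T → FinSupp T × (∀ k → (G j ⊗ H) k ≡ Xⁿ-1 n k + + q * T k)
    factorisation = exactify q (pᵏ≢0 m) (fs-⊗ fs-G fs-H) (fs-Xⁿ-1 n) (proj₂ (proj₂ (proj₁ (proj₂ (G-lift j j<m)))))

    open FactorBezout n q (G j) H (proj₁ factorisation) (proj₁ n-unit) (proj₁ (proj₂ n-unit))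
      (proj₂ (proj₂ factorisation)) (proj₁ (proj₂ factorisation)) (proj₂ (proj₂ n-unit))
      using (A; B; fs-A; fs-B; bezout)

    Gₑ Hₑ Aₑ Bₑ : El
    Gₑ = elem (G j) fs-G
    Hₑ = elem H fs-H
    Aₑ = elem A (fs-A fs-H)
    Bₑ = elem B (fs-B fs-G)

    G·H≈0 : Gₑ *ᵉ Hₑ ≈ 0ᵉ
    G·H≈0 = by-Cong (mkCong (T , δ 0 , fT , fs-δ 0 , λ k →
      trans (G⊗H≡ k) (trans (swap (Xⁿ-1 n k) (+ q * T k)) (cong (λ z → + 0 + + q * T k + z) (sym (⊗-δ0 (Xⁿ-1 n) k))))))
      where
      T : Poly
      T = proj₁ factorisation
      fT : FinSupp T
      fT = proj₁ (proj₂ factorisation)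
      G⊗H≡ : ∀ k → (G j ⊗ H) k ≡ Xⁿ-1 n k + + q * T k
      G⊗H≡ = proj₂ (proj₂ factorisation)
      swap : ∀ a b → a + b ≡ + 0 + b + a
      swap = solve-∀

    Bézout≈1 : Aₑ *ᵉ Gₑ +ᵉ Bₑ *ᵉ Hₑ ≈ 1ᵉ
    Bézout≈1 = by-Cong bezout

  open Factor using (Gₑ; Hₑ; Aₑ; Bₑ)

  chain-≤′ : ∀ {j i} → j ℕ.≤′ i → i < m → ∀ c → CyclicCode p n (g j) c → CyclicCode p n (g i) c
  chain-≤′ (ℕ.≤′-reflexive refl) _ c c∈Cj = c∈Cj
  chain-≤′ (ℕ.≤′-step {i} j≤′i) si<m c c∈Cj =
    chain i si<m c (chain-≤′ j≤′i (ℕP.<-trans (ℕP.n<1+n i) si<m) c c∈Cj)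

  -- For j ≤ i, g_j ∈ C_j ⊆ C_i, so G_j ≡ g_j ≡ g_i·K ≡ G_i·K modulo (p, X^n - 1).
  generator-multiple : ∀ j i → j < m → i < m → j ℕ.≤ i → ∃ λ K → FinSupp K × Cong n p (G j) (G i ⊗ K)
  generator-multiple j i j<m i<m j≤i = K , fK ,
    Cong-trans (Factor.G≡g j j<m) (Cong-trans gⱼ≡c (Cong-trans (Cong-sym gᵢK≡c) (Cong-*ʳ K fK (Cong-sym (Factor.G≡g i i<m)))))
    where
    open CongLaws n p
    word : ∃ λ (c : Fin n → ℤ) → ∃ λ Q → FinSupp Q × (g j ≗ (toPoly n c ⊕ (Xⁿ-1 n ⊗ Q)))
    word = reduce-to-word n 1≤n (proj₁ (Factor.fs-g j j<m)) (g j) (proj₂ (Factor.fs-g j j<m))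
    c : Fin n → ℤ
    c = proj₁ word
    gⱼ≡c : Cong n p (g j) (toPoly n c)
    gⱼ≡c = ≗Xⁿ-1⇒Cong n p (proj₁ (proj₂ (proj₂ word))) (proj₂ (proj₂ (proj₂ word)))
    gⱼ∈Cⱼ : CyclicCode p n (g j) c
    gⱼ∈Cⱼ = Cong⇒CyclicCode p n (g j) c (δ 0) (fs-δ 0)
              (Cong-trans (Cong-sym gⱼ≡c) (≗⇒Cong (λ k → sym (⊗-δ0 (g j) k))))
    c∈Cᵢ : ∃ λ F → FinSupp F × Cong n p (g i ⊗ F) (toPoly n c)
    c∈Cᵢ = CyclicCode⇒Cong p n (g i) c p≢0 (Factor.fs-g i i<m) (chain-≤′ (ℕP.≤⇒≤′ j≤i) i<m c gⱼ∈Cⱼ)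
    K : Poly
    K = proj₁ c∈Cᵢ
    fK : FinSupp K
    fK = proj₁ (proj₂ c∈Cᵢ)
    gᵢK≡c : Cong n p (g i ⊗ K) (toPoly n c)
    gᵢK≡c = proj₂ (proj₂ c∈Cᵢ)

  lifted-multiple : ∀ j i (j<m : j < m) (i<m : i < m) → j ℕ.≤ i →
    ∃ λ (K : El) → ∃ λ (W : El) → Gₑ j j<m ≈ Gₑ i i<m *ᵉ K +ᵉ scalar (+ p) *ᵉ W
  lifted-multiple j i j<m i<m j≤i = elem K fK , elem W fW ,
    by-Cong (Cong-trans Gⱼ≡GᵢK+pW (≗⇒Cong (λ k → cong (λ z → (G i ⊗ K) k + z) (sym (scalar-* (+ p) (elem W fW) k)))))
    where
    open CongLaws n q
    multiple : ∃ λ K → FinSupp K × Cong n p (G j) (G i ⊗ K)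
    multiple = generator-multiple j i j<m i<m j≤i
    K : Poly
    K = proj₁ multiple
    fK : FinSupp K
    fK = proj₁ (proj₂ multiple)
    lifted : ∃ λ W → FinSupp W × Cong n q (G j) ((G i ⊗ K) ⊕ ((+ p) ·ₚ W))
    lifted = Cong-lift n p q (proj₂ (proj₂ multiple))
    W : Poly
    W = proj₁ lifted
    fW : FinSupp W
    fW = proj₁ (proj₂ lifted)
    Gⱼ≡GᵢK+pW : Cong n q (G j) ((G i ⊗ K) ⊕ ((+ p) ·ₚ W))
    Gⱼ≡GᵢK+pW = proj₂ (proj₂ lifted)

  p-nilpotent : pow (scalar (+ p)) m ≈ 0ᵉ
  p-nilpotent = ≈-trans (powers m) (by-Cong (CongLaws.Cong-q≈0 n q))
    where
    powers : ∀ k → pow (scalar (+ p)) k ≈ scalar (+ (p ^ k))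
    powers zero = pointwise (λ k → sym (ℤP.*-identityˡ (δ 0 k)))
    powers (suc k) = ≈-trans (*-congˡ (powers k)) (pointwise (λ t →
      trans (scalar-* (+ p) (scalar (+ (p ^ k))) t)
            (trans (sym (ℤP.*-assoc (+ p) (+ (p ^ k)) (δ 0 t))) (cong (_* δ 0 t) (sym (ℤP.pos-* p (p ^ k)))))))

  G-H-orthogonal : ∀ j i (j<m : j < m) (i<m : i < m) → j ℕ.≤ i → Gₑ j j<m *ᵉ Hₑ i i<m ≈ 0ᵉ
  G-H-orthogonal j i j<m i<m j≤i with ℕP.m≤n⇒m<n∨m≡n j≤i
  ... | inj₂ refl = by-Cong (to-Cong (Factor.G·H≈0 i i<m))  -- j<m and i<m give the same polynomials
  ... | inj₁ j<i =
    orthogonal-lift (Gₑ j j<m) (Hₑ j j<m) (Aₑ j j<m) (Bₑ j j<m) (Gₑ i i<m) (Hₑ i i<m) K (scalar (+ p)) W m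
      (Factor.Bézout≈1 j j<m) (Factor.G·H≈0 j j<m) Gⱼ≈GᵢK+pW (Factor.G·H≈0 i i<m) p-nilpotent
    where
    multiple : ∃ λ (K : El) → ∃ λ (W : El) → Gₑ j j<m ≈ Gₑ i i<m *ᵉ K +ᵉ scalar (+ p) *ᵉ W
    multiple = lifted-multiple j i j<m i<m (ℕP.<⇒≤ j<i)
    K W : El
    K = proj₁ multiple
    W = proj₁ (proj₂ multiple)
    Gⱼ≈GᵢK+pW : Gₑ j j<m ≈ Gₑ i i<m *ᵉ K +ᵉ scalar (+ p) *ᵉ W
    Gⱼ≈GᵢK+pW = proj₂ (proj₂ multiple)

  -- Let eᵢ = B_i·H_i.  Every term
  -- p^j·G_j·F of a codeword satisfies p^j·G_j·F·eᵢ ≈ p^{i+1}·Y: for j ≤ i it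
  -- vanishes as G_j·H_i ≈ 0, and for j > i the factor p^j is a multiple of p^{i+1}.
  module Division (i : ℕ) (i<m : i < m) where

    eᵢ : El
    eᵢ = Bₑ i i<m *ᵉ Hₑ i i<m

    pⁱ⁺¹ : El
    pⁱ⁺¹ = scalar (+ (p ^ suc i))

    generator : ∀ j → j < m → El
    generator j j<m = elem ((+ (p ^ j)) ·ₚ G j) (fs-· (+ (p ^ j)) (Factor.fs-G j j<m))

    term-divisible : ∀ j (j<m : j < m) (F : El) → ∃ λ Y → (generator j j<m *ᵉ F) *ᵉ eᵢ ≈ pⁱ⁺¹ *ᵉ Y
    term-divisible j j<m F = by-level (j ℕP.≤? i)
      where
      by-level : Dec (j ℕ.≤ i) → ∃ λ Y → (generator j j<m *ᵉ F) *ᵉ eᵢ ≈ pⁱ⁺¹ *ᵉ Y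
      by-level (yes j≤i) = 0ᵉ , ≈-trans
        (multiple-orthogonal (generator j j<m) (Gₑ j j<m) (scalar (+ (p ^ j))) F (Bₑ i i<m) (Hₑ i i<m)
          (pointwise (λ k → sym (scalar-* (+ (p ^ j)) (Gₑ j j<m) k))) (G-H-orthogonal j i j<m i<m j≤i))
        (≈-sym (zeroʳ pⁱ⁺¹))
      by-level (no j≰i) = Y , pointwise (λ k → begin
        (((c ·ₚ G j) ⊗ poly F) ⊗ poly eᵢ) k         ≡⟨ pull c k ⟩
        c * X k                                        ≡⟨ cong (_* X k) c≡ ⟩
        (+ (p ^ suc i) * + (p ^ (j ∸ suc i))) * X k     ≡⟨ ℤP.*-assoc (+ (p ^ suc i)) _ (X k) ⟩
        + (p ^ suc i) * (+ (p ^ (j ∸ suc i)) * X k)     ≡⟨ cong (+ (p ^ suc i) *_) (sym (pull (+ (p ^ (j ∸ suc i))) k)) ⟩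
        + (p ^ suc i) * poly Y k                      ≡⟨ sym (scalar-* (+ (p ^ suc i)) Y k) ⟩
        poly (pⁱ⁺¹ *ᵉ Y) k                            ∎)
        where
        open ≡-Reasoning
        c : ℤ
        c = + (p ^ j)
        X : Poly
        X = (G j ⊗ poly F) ⊗ poly eᵢ
        Y : El
        Y = elem ((+ (p ^ (j ∸ suc i))) ·ₚ G j) (fs-· (+ (p ^ (j ∸ suc i))) (Factor.fs-G j j<m)) *ᵉ F *ᵉ eᵢ
        pull : ∀ d → (((d ·ₚ G j) ⊗ poly F) ⊗ poly eᵢ) ≗ (d ·ₚ X)
        pull d k = trans (⊗-congˡ (poly eᵢ) (⊗-scalarˡ d (G j) (poly F)) k) (⊗-scalarˡ d (G j ⊗ poly F) (poly eᵢ) k)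
        c≡ : c ≡ + (p ^ suc i) * + (p ^ (j ∸ suc i))
        c≡ = trans (cong (λ t → + (p ^ t)) (sym (ℕP.m+[n∸m]≡n (ℕP.≰⇒> j≰i))))
                   (trans (cong +_ (ℕP.^-distribˡ-+-* p (suc i) (j ∸ suc i))) (ℤP.pos-* (p ^ suc i) (p ^ (j ∸ suc i))))

    lift-sum : (F : ℕ → Poly) → (∀ j → FinSupp (F j)) → ∀ r → r ℕ.≤ m → El
    lift-sum F fF zero _ = 0ᵉ
    lift-sum F fF (suc r) r<m = lift-sum F fF r (ℕP.<⇒≤ r<m) +ᵉ generator r r<m *ᵉ (elem (F r) (fF r))

    lift-sum-≗ : ∀ F fF r r≤m → poly (lift-sum F fF r r≤m) ≗ sumPoly r (λ j → ((+ (p ^ j)) ·ₚ G j) ⊗ F j)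
    lift-sum-≗ F fF zero _ k = refl
    lift-sum-≗ F fF (suc r) r<m k = cong (_+ (((+ (p ^ r)) ·ₚ G r) ⊗ F r) k) (lift-sum-≗ F fF r (ℕP.<⇒≤ r<m) k)

    sum-divisible : ∀ F fF r r≤m → ∃ λ Y → lift-sum F fF r r≤m *ᵉ eᵢ ≈ pⁱ⁺¹ *ᵉ Y
    sum-divisible F fF zero _ = 0ᵉ , ≈-trans (zeroˡ eᵢ) (≈-sym (zeroʳ pⁱ⁺¹))
    sum-divisible F fF (suc r) r<m = proj₁ below +ᵉ proj₁ last ,
      ≈-trans (distribʳ eᵢ (lift-sum F fF r (ℕP.<⇒≤ r<m)) _)
              (≈-trans (+-cong (proj₂ below) (proj₂ last)) (≈-sym (distribˡ pⁱ⁺¹ (proj₁ below) (proj₁ last))))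
      where
      below : ∃ λ Y → lift-sum F fF r (ℕP.<⇒≤ r<m) *ᵉ eᵢ ≈ pⁱ⁺¹ *ᵉ Y
      below = sum-divisible F fF r (ℕP.<⇒≤ r<m)
      last : ∃ λ Y → (generator r r<m *ᵉ (elem (F r) (fF r))) *ᵉ eᵢ ≈ pⁱ⁺¹ *ᵉ Y
      last = term-divisible r r<m (elem (F r) (fF r))

    -- Indeed c·eᵢ ≈ p^{i+1}·Y ≡ 0 modulo
    -- p^{i+1}, and c·eᵢ = p^i·(c'·eᵢ), so p^i may be cancelled.
    divided-annihilated : ∀ c c' → LiftCode p m n G c → (∀ k → c k ≡ + (p ^ i) * c' k) →
      Cong n p (toPoly n c' ⊗ poly eᵢ) 𝟘
    divided-annihilated c c' (F , fF , Q , fQ , c∈lift) c≡pⁱc' =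
      Cong-cancel n (p ^ i) p 1≤n (pᵏ≢0 i) (Cong-≡-modulus (ℕP.*-comm p (p ^ i)) pⁱc'e≡0)
      where
      module Ci = CongLaws n (p ^ suc i)
      divisible : ∃ λ Y → lift-sum F fF m ℕP.≤-refl *ᵉ eᵢ ≈ pⁱ⁺¹ *ᵉ Y
      divisible = sum-divisible F fF m ℕP.≤-refl
      Y : El
      Y = proj₁ divisible
      cₑ : El
      cₑ = elem (toPoly n c) (fs-toPoly n c)
      sum≈c : lift-sum F fF m ℕP.≤-refl ≈ cₑ
      sum≈c = by-Cong (≡ₚ⇒Cong n q (pᵏ≢0 m) (support (lift-sum F fF m ℕP.≤-refl)) (fs-toPoly n c) fQ
                (λ k → ≡[]-substˡ (sym (lift-sum-≗ F fF m ℕP.≤-refl k)) (c∈lift k)))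
      ce≈pY : cₑ *ᵉ eᵢ ≈ pⁱ⁺¹ *ᵉ Y
      ce≈pY = ≈-trans (*-congʳ (≈-sym sum≈c)) (proj₂ divisible)
      ce≡pY : Cong n (p ^ suc i) (toPoly n c ⊗ poly eᵢ) (poly (pⁱ⁺¹ *ᵉ Y))
      ce≡pY = Cong-weaken n (p ^ suc i) (p ^ (m ∸ suc i)) (Cong-≡-modulus (q-split (suc i) i<m) (to-Cong ce≈pY))
      ce≡0 : Cong n (p ^ suc i) (toPoly n c ⊗ poly eᵢ) 𝟘
      ce≡0 = Ci.Cong-trans ce≡pY (Ci.Cong-trans (Ci.Cong-*ʳ (poly Y) (support Y) Ci.Cong-q≈0) (Ci.≗⇒Cong (𝟘-⊗ (poly Y))))
      pⁱc'e≡0 : Cong n (p ^ suc i) ((+ (p ^ i)) ·ₚ (toPoly n c' ⊗ poly eᵢ)) 𝟘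
      pⁱc'e≡0 = Ci.Cong-trans (Ci.≗⇒Cong (λ k → sym (trans (⊗-congˡ (poly eᵢ) (toPoly-scale n c c' (+ (p ^ i)) c≡pⁱc') k)
                                                            (⊗-scalarˡ (+ (p ^ i)) (toPoly n c') (poly eᵢ) k)))) ce≡0

  -- Dividing a codeword of the lift by p^i gives a codeword of C_i:
  -- modulo p, c' = c'·(A_i G_i + B_i H_i) ≡ (c'·A_i)·G_i ≡ (c'·A_i)·g_i.
  divided-codeword : ∀ i → i < m → ∀ c c' → LiftCode p m n G c → (∀ k → c k ≡ + (p ^ i) * c' k) →
    CyclicCode p n (g i) c'
  divided-codeword i i<m c c' c∈lift c≡pⁱc' =
    Cong⇒CyclicCode p n (g i) c' (toPoly n c' ⊗ Rp.poly Aₚ) (fs-⊗ (fs-toPoly n c') (Rp.support Aₚ)) c'≡gc'A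
    where
    module Rp = QuotientRing n p
    open CommutativeRing Rp.ring using () renaming
      (*-congˡ to *-congˡₚ; +-cong to +-congₚ; *-identityʳ to *-identityʳₚ; +-identityʳ to +-identityʳₚ;
       distribˡ to distribˡₚ; *-assoc to *-assocₚ; *-comm to *-commₚ; sym to symₚ; setoid to setoidₚ)
    open SetoidReasoning setoidₚ
    c'ₑ Aₚ Gₚ gₚ Bₚ Hₚ : Rp.El
    c'ₑ = Rp.elem (toPoly n c') (fs-toPoly n c')
    Aₚ = Rp.elem (poly (Aₑ i i<m)) (support (Aₑ i i<m))
    Bₚ = Rp.elem (poly (Bₑ i i<m)) (support (Bₑ i i<m))
    Gₚ = Rp.elem (G i) (Factor.fs-G i i<m)
    Hₚ = Rp.elem (poly (Hₑ i i<m)) (support (Hₑ i i<m))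
    gₚ = Rp.elem (g i) (Factor.fs-g i i<m)
    bezoutₚ : Aₚ Rp.*ᵉ Gₚ Rp.+ᵉ Bₚ Rp.*ᵉ Hₚ Rp.≈ Rp.1ᵉ
    bezoutₚ = Rp.by-Cong (Cong-weaken n p (p ^ (m ∸ 1)) (Cong-≡-modulus q≡p·pᵐ⁻¹ (to-Cong (Factor.Bézout≈1 i i<m))))
      where
      q≡p·pᵐ⁻¹ : q ≡ p ℕ.* p ^ (m ∸ 1)
      q≡p·pᵐ⁻¹ = trans (q-split 1 1≤m) (cong (ℕ._* p ^ (m ∸ 1)) (ℕP.*-identityʳ p))
    c'≡gc'A : Cong n p (toPoly n c') (g i ⊗ (toPoly n c' ⊗ Rp.poly Aₚ))
    c'≡gc'A = Rp.to-Cong (begin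
      c'ₑ                                             ≈⟨ symₚ (*-identityʳₚ c'ₑ) ⟩
      c'ₑ Rp.*ᵉ Rp.1ᵉ                                 ≈⟨ *-congˡₚ (symₚ bezoutₚ) ⟩
      c'ₑ Rp.*ᵉ (Aₚ Rp.*ᵉ Gₚ Rp.+ᵉ Bₚ Rp.*ᵉ Hₚ)        ≈⟨ distribˡₚ c'ₑ _ _ ⟩
      c'ₑ Rp.*ᵉ (Aₚ Rp.*ᵉ Gₚ) Rp.+ᵉ c'ₑ Rp.*ᵉ (Bₚ Rp.*ᵉ Hₚ)
        ≈⟨ +-congₚ (symₚ (*-assocₚ c'ₑ Aₚ Gₚ)) (Rp.by-Cong (Division.divided-annihilated i i<m c c' c∈lift c≡pⁱc')) ⟩
      (c'ₑ Rp.*ᵉ Aₚ) Rp.*ᵉ Gₚ Rp.+ᵉ Rp.0ᵉ               ≈⟨ +-identityʳₚ _ ⟩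
      (c'ₑ Rp.*ᵉ Aₚ) Rp.*ᵉ Gₚ                         ≈⟨ *-congˡₚ (Rp.by-Cong (Factor.G≡g i i<m)) ⟩
      (c'ₑ Rp.*ᵉ Aₚ) Rp.*ᵉ gₚ                         ≈⟨ *-commₚ _ gₚ ⟩
      gₚ Rp.*ᵉ (c'ₑ Rp.*ᵉ Aₚ)                         ∎)

  divided-codeword-kind : ∀ kind i → i < m → ∀ a a' → KindCode kind q n (LiftCode p m n G) a →
    (∀ k → a k ≡ + (p ^ i) * a' k) → KindCode kind p n (CyclicCode p n (g i)) a'
  divided-codeword-kind cyclic i i<m = divided-codeword i i<m
  divided-codeword-kind extended i i<m a a' a∈lift a≡pⁱa' =
    divide-extended n p (p ^ i) (p ^ (m ∸ suc i)) (LiftCode p m n G) (CyclicCode p n (g i)) (pᵏ≢0 i)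
      (divided-codeword i i<m) a a' (subst (λ r → Extended r n (LiftCode p m n G) a) q≡ a∈lift) a≡pⁱa'
    where
    q≡ : q ≡ p ^ i ℕ.* (p ℕ.* p ^ (m ∸ suc i))
    q≡ = trans (q-split (suc i) i<m) (trans (cong (ℕ._* p ^ (m ∸ suc i)) (ℕP.*-comm p (p ^ i))) (ℕP.*-assoc (p ^ i) p _))

open import Data.Nat using (_*_; _∸_; _^_)
open import Data.Rational as ℚ using (ℚ; 1ℚ)
open ValuationBound using (layered-minimum)

theorem2p8 : (p : ℕ) → Prime p → (m : ℕ) → 1 ≤ m → (n : ℕ) → 1 ≤ n → ¬ (p ∣ n) →
  (kind : CodeKind) →
  -- generator polynomials g_j of the cyclic codes C_j and their Hensel lifts G_j
  (g G : ℕ → Poly) →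
  (∀ j → j < m → IsGenerator p n (g j)) →
  (∀ j → j < m → IsHenselLift p m n (g j) (G j)) →
  -- chain condition C_0 ⊆ C_1 ⊆ … ⊆ C_{m-1}
  (∀ j → suc j < m → ∀ c → CyclicCode p n (g j) c → CyclicCode p n (g (suc j)) c) →
  (γ : ℚ) → 1ℚ ℚ.≤ γ →
  (∀ i → i < m →
    DistE≥ p (len kind n) (KindCode kind p n (CyclicCode p n (g i))) (p ^ (2 * m ∸ 2 * i)) γ) →
  MinLattice≥ p m (len kind n) (KindCode kind (p ^ m) n (LiftCode p m n G)) (p ^ m) γ
theorem2p8 p p-prime m 1≤m n 1≤n p∤n kind g G g-generator G-lift chain γ 1≤γ dist =
  layered-minimum p m (len kind n) (KindCode kind (p ^ m) n (LiftCode p m n G))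
    (λ i → KindCode kind p n (CyclicCode p n (g i))) γ 1≤γ
    (λ i i<m → divided-codeword-kind kind i i<m) dist
  where
  open LiftedChain p p-prime m 1≤m n 1≤n p∤n g G g-generator G-lift chain using (divided-codeword-kind)
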